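{- For all integers $J\ge 0$ and $N\ge 0$, $$MO(2,9J+4;27N+9)\equiv 0\pmod 3\qquad\text{and}\qquad MO(2,9J+7;27N)\equiv 0\pmod 3.$$
   Context: For an integer $a$ and a nonnegative integer $t$, define $MO(a,t;n)$ by the formal power series identity $$\sum_{n\ge 0}MO(a,t;n)\,q^n=\sum_{1\le n_1<n_2<\cdots<n_t}\frac{q^{n_1+n_2+\cdots+n_t}}{\prod_{k=1}^t(1+aq^{n_k}+q^{2n_k})},$$ where each factor $1/(1+aq^{m}+q^{2m})$ is expanded as a power series in $q$ with integer coefficients. -}

module Defs where

open import Data.Nat as ℕ using (ℕ; zero; suc; _≡ᵇ_; _≤ᵇ_; _∸_)
open import Data.Integer using (ℤ; +_; -_; _+_; _*_; 0ℤ; 1ℤ)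
open import Data.Nat.DivMod using (_%_; _/_)
open import Data.Bool using (if_then_else_; _∧_)
open import Data.Product using (_×_; _,_; proj₁)

-- Coefficients of the power series 1/(1 + a x + x^2) = Σ_i c a i x^i:
-- c 0 = 1, c 1 = -a, c (i+2) = -a * c (i+1) - c i.
cpair : ℤ → ℕ → ℤ × ℤ
cpair a zero = 1ℤ , - a
cpair a (suc i) with cpair a i
... | u , v = v , ((- a) * v + - u)

c : ℤ → ℕ → ℤ
c a i = proj₁ (cpair a i)

-- g a m j = coefficient of q^j in q^m / (1 + a q^m + q^(2m)), for m ≥ 1
-- (nonzero only when j = m*(i+1), where it equals c a i).  Unused for m = 0.
g : ℤ → ℕ → ℕ → ℤ
g a zero j = 0ℤ
g a (suc m) j =
  if ((j % suc m) ≡ᵇ 0) ∧ (1 ≤ᵇ (j / suc m))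
  then c a ((j / suc m) ∸ 1)
  else 0ℤ

Σ≤ : ℕ → (ℕ → ℤ) → ℤ
Σ≤ zero f = f 0
Σ≤ (suc n) f = Σ≤ n f + f (suc n)

-- F a t m n = coefficient of q^n in
--   Σ_{m ≤ n_1 < ... < n_t} Π_k q^{n_k} / (1 + a q^{n_k} + q^{2 n_k})   (requires m ≥ 1).
-- Recursion: choose the smallest part k ≥ m (necessarily k ≤ n since the
-- factor for k is divisible by q^k), take q^j from its factor, recurse on
-- the remaining t parts, all > k.
F : ℤ → ℕ → ℕ → ℕ → ℤ
F a zero m n = if n ≡ᵇ 0 then 1ℤ else 0ℤ
F a (suc t) m n =
  Σ≤ n (λ k → if m ≤ᵇ k
                then Σ≤ n (λ j → if j ≤ᵇ n then g a k j * F a t (suc k) (n ∸ j) else 0ℤ)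
                else 0ℤ)

-- MO(a,t;n) from the paper: coefficient of q^n in
--   Σ_{1 ≤ n_1 < ... < n_t} q^{n_1+...+n_t} / Π_k (1 + a q^{n_k} + q^{2 n_k}).
MO : ℤ → ℕ → ℕ → ℤ
MO a t n = F a t 1 n

module Submission where

-- Work modulo 3. Put ψ = Σ_k q^(k(k+1)/2), let b_k(z) = Σ_t C(k+t, 2t) zᵗ be the
-- Morgan–Voyce polynomials and Φ_t = Σ_k C(k+t, 2t) q^(k(k+1)/2).
--
-- The generating function Σ_t MO(2,t;q) zᵗ is Π_{m≥1} (1 + z q^m/(1+q^m)²). A finite form of
-- Jacobi's triple product, Π_{m≤N} ((1+q^m)² + z q^m) = Σ_{k≤N} q^(k(k+1)/2) [2N+1, N+k+1]_q b_k(z),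
-- holds in every commutative semiring. As [2N+1, N+k+1]_q ≡ [2N+1, N+1]_q modulo q^(N+1-k),
-- comparing it with its value at z = 0 modulo q^(N+1) and cancelling the unit [2N+1, N+1]_q
-- yields MO(2,t;q) ψ = Φ_t.
--
-- By Frobenius ψ²⁷ = ψ(q²⁷), so after multiplying by ψ²⁶ each 27-section of MO(2,t;q), times ψ,
-- is the corresponding section of Φ_t ψ²⁶; as ψ(0) = 1 it suffices that this section vanishes.
-- The exponents of ψ are never ≡ 2 (mod 3), and those ≡ 1 are 9T + 1 with T triangular, so ψ²⁶
-- has no exponent ≡ 26 (mod 27). By Lucas' theorem modulo 9, C(k+t, 2t) ≢ 0 forces k ≡ 4 (mod 9)
-- when t ≡ 4, and k ≡ 1, 7 (mod 9) when t ≡ 7; then k(k+1)/2 ≡ 10, resp. 1 (mod 27), so each term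
-- of Φ_t ψ²⁶ at exponent 27N + 9, resp. 27N, meets a missing exponent of ψ²⁶.

open import Algebra.Bundles using (CommutativeRing; CommutativeSemiring)

module Mod3 where

  import Algebra.Solver.Ring as RingSolver
  open import Algebra.Solver.Ring.AlmostCommutativeRing
    using (_-Raw-AlmostCommutative⟶_; fromCommutativeRing)
  open import Data.Integer as ℤ using (ℤ; +_; -[1+_]; _⊖_)
  import Data.Integer.Divisibility as ℤ
  import Data.Integer.Properties as ℤ
  open import Data.Maybe using (Maybe; just; nothing)
  open import Data.Nat as ℕ using (ℕ; zero; suc)
  open import Data.Nat.Divisibility as ℕ using (divides)
  open import Data.Product using (_,_)
  open import Level using (0ℓ)
  open import Relation.Binary.PropositionalEquality

  data 𝔽₃ : Set where
    0₃ 1₃ 2₃ : 𝔽₃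

  infixl 6 _+₃_
  infixl 7 _*₃_
  infix 8 -₃_

  _+₃_ : 𝔽₃ → 𝔽₃ → 𝔽₃
  0₃ +₃ y  = y
  1₃ +₃ 0₃ = 1₃
  1₃ +₃ 1₃ = 2₃
  1₃ +₃ 2₃ = 0₃
  2₃ +₃ 0₃ = 2₃
  2₃ +₃ 1₃ = 0₃
  2₃ +₃ 2₃ = 1₃

  _*₃_ : 𝔽₃ → 𝔽₃ → 𝔽₃
  0₃ *₃ y  = 0₃
  1₃ *₃ y  = y
  2₃ *₃ 0₃ = 0₃
  2₃ *₃ 1₃ = 2₃
  2₃ *₃ 2₃ = 1₃

  -₃_ : 𝔽₃ → 𝔽₃
  -₃ 0₃ = 0₃
  -₃ 1₃ = 2₃
  -₃ 2₃ = 1₃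

  private
    +-assoc : ∀ x y z → (x +₃ y) +₃ z ≡ x +₃ (y +₃ z)
    +-assoc 0₃ y  z  = refl
    +-assoc 1₃ 0₃ z  = refl
    +-assoc 1₃ 1₃ 0₃ = refl
    +-assoc 1₃ 1₃ 1₃ = refl
    +-assoc 1₃ 1₃ 2₃ = refl
    +-assoc 1₃ 2₃ 0₃ = refl
    +-assoc 1₃ 2₃ 1₃ = refl
    +-assoc 1₃ 2₃ 2₃ = refl
    +-assoc 2₃ 0₃ z  = refl
    +-assoc 2₃ 1₃ 0₃ = refl
    +-assoc 2₃ 1₃ 1₃ = refl
    +-assoc 2₃ 1₃ 2₃ = refl
    +-assoc 2₃ 2₃ 0₃ = refl
    +-assoc 2₃ 2₃ 1₃ = refl
    +-assoc 2₃ 2₃ 2₃ = refl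

    +-comm : ∀ x y → x +₃ y ≡ y +₃ x
    +-comm 0₃ 0₃ = refl
    +-comm 0₃ 1₃ = refl
    +-comm 0₃ 2₃ = refl
    +-comm 1₃ 0₃ = refl
    +-comm 1₃ 1₃ = refl
    +-comm 1₃ 2₃ = refl
    +-comm 2₃ 0₃ = refl
    +-comm 2₃ 1₃ = refl
    +-comm 2₃ 2₃ = refl

    +-identityʳ : ∀ x → x +₃ 0₃ ≡ x
    +-identityʳ 0₃ = refl
    +-identityʳ 1₃ = refl
    +-identityʳ 2₃ = refl

    -‿inverseˡ : ∀ x → -₃ x +₃ x ≡ 0₃
    -‿inverseˡ 0₃ = refl
    -‿inverseˡ 1₃ = refl
    -‿inverseˡ 2₃ = refl

    -‿inverseʳ : ∀ x → x +₃ -₃ x ≡ 0₃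
    -‿inverseʳ 0₃ = refl
    -‿inverseʳ 1₃ = refl
    -‿inverseʳ 2₃ = refl

    *-assoc : ∀ x y z → (x *₃ y) *₃ z ≡ x *₃ (y *₃ z)
    *-assoc 0₃ y  z  = refl
    *-assoc 1₃ y  z  = refl
    *-assoc 2₃ 0₃ z  = refl
    *-assoc 2₃ 1₃ z  = refl
    *-assoc 2₃ 2₃ 0₃ = refl
    *-assoc 2₃ 2₃ 1₃ = refl
    *-assoc 2₃ 2₃ 2₃ = refl

    *-comm : ∀ x y → x *₃ y ≡ y *₃ x
    *-comm 0₃ 0₃ = refl
    *-comm 0₃ 1₃ = refl
    *-comm 0₃ 2₃ = refl
    *-comm 1₃ 0₃ = refl
    *-comm 1₃ 1₃ = refl
    *-comm 1₃ 2₃ = refl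
    *-comm 2₃ 0₃ = refl
    *-comm 2₃ 1₃ = refl
    *-comm 2₃ 2₃ = refl

    *-identityʳ : ∀ x → x *₃ 1₃ ≡ x
    *-identityʳ 0₃ = refl
    *-identityʳ 1₃ = refl
    *-identityʳ 2₃ = refl

    *-distribˡ-+ : ∀ x y z → x *₃ (y +₃ z) ≡ x *₃ y +₃ x *₃ z
    *-distribˡ-+ 0₃ y  z  = refl
    *-distribˡ-+ 1₃ y  z  = refl
    *-distribˡ-+ 2₃ 0₃ z  = refl
    *-distribˡ-+ 2₃ 1₃ 0₃ = refl
    *-distribˡ-+ 2₃ 1₃ 1₃ = refl
    *-distribˡ-+ 2₃ 1₃ 2₃ = refl
    *-distribˡ-+ 2₃ 2₃ 0₃ = refl
    *-distribˡ-+ 2₃ 2₃ 1₃ = refl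
    *-distribˡ-+ 2₃ 2₃ 2₃ = refl

    *-distribʳ-+ : ∀ x y z → (y +₃ z) *₃ x ≡ y *₃ x +₃ z *₃ x
    *-distribʳ-+ x y z rewrite *-comm (y +₃ z) x | *-comm y x | *-comm z x = *-distribˡ-+ x y z

  𝔽₃-commutativeRing : CommutativeRing 0ℓ 0ℓ
  𝔽₃-commutativeRing = record
    { Carrier = 𝔽₃ ; _≈_ = _≡_ ; _+_ = _+₃_ ; _*_ = _*₃_ ; -_ = -₃_ ; 0# = 0₃ ; 1# = 1₃
    ; isCommutativeRing = record
      { isRing = record
        { +-isAbelianGroup = record
          { isGroup = record
            { isMonoid = record
              { isSemigroup = record
                { isMagma = record { isEquivalence = isEquivalence ; ∙-cong = cong₂ _+₃_ }
                ; assoc = +-assoc }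
              ; identity = (λ _ → refl) , +-identityʳ }
            ; inverse = -‿inverseˡ , -‿inverseʳ
            ; ⁻¹-cong = cong -₃_ }
          ; comm = +-comm }
        ; *-cong = cong₂ _*₃_
        ; *-assoc = *-assoc
        ; *-identity = (λ _ → refl) , *-identityʳ
        ; distrib = *-distribˡ-+ , *-distribʳ-+ }
      ; *-comm = *-comm } }

  cube-id : ∀ x → x *₃ x *₃ x ≡ x
  cube-id 0₃ = refl
  cube-id 1₃ = refl
  cube-id 2₃ = refl

  -- Ring solver for rings R with a ring map ι : 𝔽₃ → R; its constants live in 𝔽₃,
  -- so it knows that 1 + 1 + 1 = 0 in R.
  module 𝔽₃-AlgebraSolver {c ℓ} (R : CommutativeRing c ℓ)
    (ι : CommutativeRing.rawRing 𝔽₃-commutativeRing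
           -Raw-AlmostCommutative⟶ fromCommutativeRing R) where

    private
      module R = CommutativeRing R
      open _-Raw-AlmostCommutative⟶_ ι using (⟦_⟧)

      _≟-ι_ : ∀ a b → Maybe (⟦ a ⟧ R.≈ ⟦ b ⟧)
      0₃ ≟-ι 0₃ = just R.refl
      1₃ ≟-ι 1₃ = just R.refl
      2₃ ≟-ι 2₃ = just R.refl
      _  ≟-ι _  = nothing

    open RingSolver (CommutativeRing.rawRing 𝔽₃-commutativeRing) (fromCommutativeRing R) ι _≟-ι_ public

  𝔽₃-id : CommutativeRing.rawRing 𝔽₃-commutativeRing
            -Raw-AlmostCommutative⟶ fromCommutativeRing 𝔽₃-commutativeRing
  𝔽₃-id = record
    { ⟦_⟧ = λ x → x ; +-homo = λ _ _ → refl ; *-homo = λ _ _ → refl ; -‿homo = λ _ → refl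
    ; 0-homo = refl ; 1-homo = refl }

  module 𝔽₃-Solver = 𝔽₃-AlgebraSolver 𝔽₃-commutativeRing 𝔽₃-id

  open 𝔽₃-Solver using (solve; _:=_; _:+_; _:*_; :-_; con)

  fromℕ : ℕ → 𝔽₃
  fromℕ zero    = 0₃
  fromℕ (suc n) = 1₃ +₃ fromℕ n

  fromℕ-+ : ∀ m n → fromℕ (m ℕ.+ n) ≡ fromℕ m +₃ fromℕ n
  fromℕ-+ zero    n = refl
  fromℕ-+ (suc m) n = trans (cong (1₃ +₃_) (fromℕ-+ m n)) (sym (+-assoc 1₃ (fromℕ m) (fromℕ n)))

  fromℕ≡0⇒3∣ : ∀ n → fromℕ n ≡ 0₃ → 3 ℕ.∣ n
  fromℕ≡0⇒3∣ zero                _ = divides 0 refl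
  fromℕ≡0⇒3∣ (suc (suc (suc n))) e with fromℕ≡0⇒3∣ n (trans (sym (fromℕ-+ 3 n)) e)
  ... | divides k n≡k*3 = divides (suc k) (cong (3 ℕ.+_) n≡k*3)

  fromℤ : ℤ → 𝔽₃
  fromℤ (+ n)    = fromℕ n
  fromℤ -[1+ n ] = -₃ fromℕ (suc n)

  fromℤ-⊖ : ∀ m n → fromℤ (m ⊖ n) ≡ fromℕ m +₃ -₃ fromℕ n
  fromℤ-⊖ m       zero    = sym (+-identityʳ (fromℕ m))
  fromℤ-⊖ zero    (suc n) = refl
  fromℤ-⊖ (suc m) (suc n) = begin
    fromℤ (suc m ⊖ suc n)                  ≡⟨ cong fromℤ (ℤ.[1+m]⊖[1+n]≡m⊖n m n) ⟩
    fromℤ (m ⊖ n)                          ≡⟨ fromℤ-⊖ m n ⟩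
    fromℕ m +₃ -₃ fromℕ n                  ≡⟨ solve 2 (λ a b → a :+ :- b := (con 1₃ :+ a) :+ :- (con 1₃ :+ b))
                                                      refl (fromℕ m) (fromℕ n) ⟩
    fromℕ (suc m) +₃ -₃ fromℕ (suc n)      ∎
    where open ≡-Reasoning

  fromℤ-+ : ∀ i j → fromℤ (i ℤ.+ j) ≡ fromℤ i +₃ fromℤ j
  fromℤ-+ -[1+ m ] -[1+ n ] = begin
    -₃ (1₃ +₃ fromℕ (suc m ℕ.+ n))              ≡⟨ cong (λ x → -₃ (1₃ +₃ x)) (fromℕ-+ (suc m) n) ⟩
    -₃ (1₃ +₃ (fromℕ (suc m) +₃ fromℕ n))       ≡⟨ solve 2 (λ a b → :- (con 1₃ :+ (a :+ b)) := :- a :+ :- (con 1₃ :+ b))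
                                                           refl (fromℕ (suc m)) (fromℕ n) ⟩
    -₃ fromℕ (suc m) +₃ -₃ fromℕ (suc n)        ∎
    where open ≡-Reasoning
  fromℤ-+ -[1+ m ] (+ n)    = trans (fromℤ-⊖ n (suc m)) (+-comm (fromℕ n) _)
  fromℤ-+ (+ m)    -[1+ n ] = fromℤ-⊖ m (suc n)
  fromℤ-+ (+ m)    (+ n)    = fromℕ-+ m n

  fromℤ-neg : ∀ i → fromℤ (ℤ.- i) ≡ -₃ fromℤ i
  fromℤ-neg (+ zero)  = refl
  fromℤ-neg (+ suc n) = refl
  fromℤ-neg -[1+ n ]  = sym (solve 1 (λ a → :- :- a := a) refl (fromℕ (suc n)))

  private
    fromℤ-+* : ∀ n j → fromℤ (+ n ℤ.* j) ≡ fromℕ n *₃ fromℤ j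
    fromℤ-+* zero    j = refl
    fromℤ-+* (suc n) j = begin
      fromℤ (+ suc n ℤ.* j)                ≡⟨ cong fromℤ (ℤ.suc-* (+ n) j) ⟩
      fromℤ (j ℤ.+ + n ℤ.* j)              ≡⟨ fromℤ-+ j (+ n ℤ.* j) ⟩
      fromℤ j +₃ fromℤ (+ n ℤ.* j)         ≡⟨ cong (fromℤ j +₃_) (fromℤ-+* n j) ⟩
      fromℤ j +₃ fromℕ n *₃ fromℤ j        ≡⟨ sym (*-distribʳ-+ (fromℤ j) 1₃ (fromℕ n)) ⟩
      fromℕ (suc n) *₃ fromℤ j             ∎
      where open ≡-Reasoning

  fromℤ-* : ∀ i j → fromℤ (i ℤ.* j) ≡ fromℤ i *₃ fromℤ j
  fromℤ-* (+ n)    j = fromℤ-+* n j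
  fromℤ-* -[1+ n ] j = begin
    fromℤ (-[1+ n ] ℤ.* j)               ≡⟨ cong fromℤ (sym (ℤ.neg-distribˡ-* (+ suc n) j)) ⟩
    fromℤ (ℤ.- (+ suc n ℤ.* j))          ≡⟨ fromℤ-neg (+ suc n ℤ.* j) ⟩
    -₃ fromℤ (+ suc n ℤ.* j)             ≡⟨ cong -₃_ (fromℤ-+* (suc n) j) ⟩
    -₃ (fromℕ (suc n) *₃ fromℤ j)        ≡⟨ solve 2 (λ a b → :- (a :* b) := :- a :* b) refl (fromℕ (suc n)) (fromℤ j) ⟩
    -₃ fromℕ (suc n) *₃ fromℤ j          ∎
    where open ≡-Reasoning

  fromℤ≡0⇒3∣ : ∀ i → fromℤ i ≡ 0₃ → + 3 ℤ.∣ i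
  fromℤ≡0⇒3∣ (+ n)    e = fromℕ≡0⇒3∣ n e
  fromℤ≡0⇒3∣ -[1+ n ] e = fromℕ≡0⇒3∣ (suc n) (trans (solve 1 (λ a → a := :- :- a) refl (fromℕ (suc n))) (cong -₃_ e))

module FiniteSums {c ℓ} (S : CommutativeSemiring c ℓ) where

  open import Data.Nat using (ℕ; zero; suc; _≤_; z≤n; s≤s)
  open import Data.Sum using (inj₁; inj₂)
  open import Relation.Binary.PropositionalEquality as ≡ using (_≢_)
  import Data.Nat.Properties as ℕ
  open import Algebra.Solver.Ring.NaturalCoefficients.Default S using (solve; _:=_; _:+_)

  open CommutativeSemiring S

  ∑≤ : ℕ → (ℕ → Carrier) → Carrier
  ∑≤ zero    f = f 0
  ∑≤ (suc n) f = ∑≤ n f + f (suc n)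

  syntax ∑≤ n (λ k → e) = ∑[ k ≤ n ] e

  ∑≤-cong : ∀ n {f g} → (∀ k → k ≤ n → f k ≈ g k) → ∑≤ n f ≈ ∑≤ n g
  ∑≤-cong zero    f≈g = f≈g 0 z≤n
  ∑≤-cong (suc n) f≈g = +-cong (∑≤-cong n (λ k k≤n → f≈g k (ℕ.m≤n⇒m≤1+n k≤n))) (f≈g (suc n) ℕ.≤-refl)

  ∑≤-zero : ∀ n {f} → (∀ k → k ≤ n → f k ≈ 0#) → ∑≤ n f ≈ 0#
  ∑≤-zero n {f} f≈0 = trans (∑≤-cong n f≈0) (zero-sum n)
    where
    zero-sum : ∀ n → ∑≤ n (λ _ → 0#) ≈ 0#
    zero-sum zero    = refl
    zero-sum (suc n) = trans (+-congʳ (zero-sum n)) (+-identityˡ 0#)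

  ∑≤-distrib-+ : ∀ n f g → ∑[ k ≤ n ] (f k + g k) ≈ ∑≤ n f + ∑≤ n g
  ∑≤-distrib-+ zero    f g = refl
  ∑≤-distrib-+ (suc n) f g = trans (+-congʳ (∑≤-distrib-+ n f g))
    (solve 4 (λ a b c d → (a :+ b) :+ (c :+ d) := (a :+ c) :+ (b :+ d)) refl _ _ _ _)

  ∑≤-distribʳ-* : ∀ n f x → ∑≤ n f * x ≈ ∑[ k ≤ n ] (f k * x)
  ∑≤-distribʳ-* zero    f x = refl
  ∑≤-distribʳ-* (suc n) f x = trans (distribʳ x _ _) (+-congʳ (∑≤-distribʳ-* n f x))

  ∑≤-distribˡ-* : ∀ n f x → x * ∑≤ n f ≈ ∑[ k ≤ n ] (x * f k)
  ∑≤-distribˡ-* n f x = trans (*-comm x _) (trans (∑≤-distribʳ-* n f x) (∑≤-cong n (λ k _ → *-comm (f k) x)))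

  ∑≤-suc : ∀ n f → ∑≤ (suc n) f ≈ f 0 + ∑[ k ≤ n ] f (suc k)
  ∑≤-suc zero    f = refl
  ∑≤-suc (suc n) f = trans (+-congʳ (∑≤-suc n f)) (+-assoc _ _ _)

  ∑≤-single : ∀ n {f} k → k ≤ n → (∀ j → j ≤ n → j ≢ k → f j ≈ 0#) → ∑≤ n f ≈ f k
  ∑≤-single zero    zero _ _ = refl
  ∑≤-single (suc n) k k≤1+n others with ℕ.m≤n⇒m<n∨m≡n k≤1+n
  ... | inj₁ (s≤s k≤n) = trans (+-congˡ (others (suc n) ℕ.≤-refl (λ e → ℕ.<⇒≢ (s≤s k≤n) (≡.sym e))))
                          (trans (+-identityʳ _) (∑≤-single n k k≤n (λ j j≤n → others j (ℕ.m≤n⇒m≤1+n j≤n))))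
  ... | inj₂ ≡.refl    = trans (+-congʳ (∑≤-zero n (λ j j≤n → others j (ℕ.m≤n⇒m≤1+n j≤n) (ℕ.<⇒≢ (s≤s j≤n)))))
                          (+-identityˡ _)

module PowerSeries {c ℓ} (R : CommutativeRing c ℓ) where

  open import Algebra.Solver.Ring.AlmostCommutativeRing
    using (_-Raw-AlmostCommutative⟶_; fromCommutativeRing)
  open import Data.Nat as ℕ using (ℕ; zero; suc; _≤_; _<_; _∸_; z≤n; s≤s)
  import Data.Nat.Properties as ℕ
  open import Data.Product using (_,_)
  open import Relation.Binary.Core using (Rel)
  open import Data.Empty using (⊥-elim)
  import Relation.Binary.PropositionalEquality as ≡
  open ≡ using (_≢_)

  open CommutativeRing R
  open import Algebra.Solver.Ring.NaturalCoefficients.Default commutativeSemiring using (solve; _:=_; _:+_; _:*_)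
  open import Relation.Binary.Reasoning.Setoid setoid
  open FiniteSums commutativeSemiring public

  Series : Set c
  Series = ℕ → Carrier

  infix 4 _≋_
  _≋_ : Rel Series ℓ
  f ≋ g = ∀ n → f n ≈ g n

  ≋-refl : ∀ {f} → f ≋ f
  ≋-refl n = refl

  ≋-sym : ∀ {f g} → f ≋ g → g ≋ f
  ≋-sym f≋g n = sym (f≋g n)

  ≋-trans : ∀ {f g h} → f ≋ g → g ≋ h → f ≋ h
  ≋-trans f≋g g≋h n = trans (f≋g n) (g≋h n)

  const : Carrier → Series
  const a zero    = a
  const a (suc n) = 0#

  0s 1s : Series
  0s n = 0#
  1s   = const 1#

  infixl 6 _⊕_
  infixl 7 _⊛_ _·_
  infix  8 ⊝_

  _⊕_ : Series → Series → Series
  (f ⊕ g) n = f n + g n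

  ⊝_ : Series → Series
  (⊝ f) n = - f n

  _·_ : Carrier → Series → Series
  (a · f) n = a * f n

  tail : Series → Series
  tail f n = f (suc n)

  shift : Series → Series
  shift f zero    = 0#
  shift f (suc n) = f n

  _⊛_ : Series → Series → Series
  (f ⊛ g) zero    = f 0 * g 0
  (f ⊛ g) (suc n) = f 0 * g (suc n) + (tail f ⊛ g) n

  ⊛-cong : ∀ {f f′ g g′} → f ≋ f′ → g ≋ g′ → f ⊛ g ≋ f′ ⊛ g′
  ⊛-cong f≋f′ g≋g′ zero    = *-cong (f≋f′ 0) (g≋g′ 0)
  ⊛-cong f≋f′ g≋g′ (suc n) = +-cong (*-cong (f≋f′ 0) (g≋g′ (suc n))) (⊛-cong (λ k → f≋f′ (suc k)) g≋g′ n)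

  ⊛-zeroˡ : ∀ g → 0s ⊛ g ≋ 0s
  ⊛-zeroˡ g zero    = zeroˡ (g 0)
  ⊛-zeroˡ g (suc n) = trans (+-cong (zeroˡ _) (⊛-zeroˡ g n)) (+-identityˡ 0#)

  ⊛-identityˡ : ∀ g → 1s ⊛ g ≋ g
  ⊛-identityˡ g zero    = *-identityˡ (g 0)
  ⊛-identityˡ g (suc n) = trans (+-cong (*-identityˡ _) (⊛-zeroˡ g n)) (+-identityʳ _)

  ⊛-identityʳ : ∀ f → f ⊛ 1s ≋ f
  ⊛-identityʳ f zero    = *-identityʳ (f 0)
  ⊛-identityʳ f (suc n) = trans (+-cong (zeroʳ _) (⊛-identityʳ (tail f) n)) (+-identityˡ _)

  ⊛-distribʳ : ∀ f f′ g → (f ⊕ f′) ⊛ g ≋ f ⊛ g ⊕ f′ ⊛ g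
  ⊛-distribʳ f f′ g zero    = distribʳ (g 0) (f 0) (f′ 0)
  ⊛-distribʳ f f′ g (suc n) = begin
    (f 0 + f′ 0) * g (suc n) + ((tail f ⊕ tail f′) ⊛ g) n
      ≈⟨ +-cong (distribʳ _ _ _) (⊛-distribʳ (tail f) (tail f′) g n) ⟩
    (f 0 * g (suc n) + f′ 0 * g (suc n)) + ((tail f ⊛ g) n + (tail f′ ⊛ g) n)
      ≈⟨ solve 4 (λ a b c d → (a :+ b) :+ (c :+ d) := (a :+ c) :+ (b :+ d)) refl _ _ _ _ ⟩
    (f 0 * g (suc n) + (tail f ⊛ g) n) + (f′ 0 * g (suc n) + (tail f′ ⊛ g) n) ∎

  ⊛-distribˡ : ∀ f g g′ → f ⊛ (g ⊕ g′) ≋ f ⊛ g ⊕ f ⊛ g′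
  ⊛-distribˡ f g g′ zero    = distribˡ (f 0) (g 0) (g′ 0)
  ⊛-distribˡ f g g′ (suc n) = begin
    f 0 * (g (suc n) + g′ (suc n)) + (tail f ⊛ (g ⊕ g′)) n
      ≈⟨ +-cong (distribˡ _ _ _) (⊛-distribˡ (tail f) g g′ n) ⟩
    (f 0 * g (suc n) + f 0 * g′ (suc n)) + ((tail f ⊛ g) n + (tail f ⊛ g′) n)
      ≈⟨ solve 4 (λ a b c d → (a :+ b) :+ (c :+ d) := (a :+ c) :+ (b :+ d)) refl _ _ _ _ ⟩
    (f 0 * g (suc n) + (tail f ⊛ g) n) + (f 0 * g′ (suc n) + (tail f ⊛ g′) n) ∎

  ·-⊛ : ∀ a f g → (a · f) ⊛ g ≋ a · (f ⊛ g)
  ·-⊛ a f g zero    = *-assoc _ _ _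
  ·-⊛ a f g (suc n) = trans (+-cong (*-assoc _ _ _) (·-⊛ a (tail f) g n)) (sym (distribˡ _ _ _))

  ⊛-tailʳ : ∀ f g n → (f ⊛ g) (suc n) ≈ g 0 * f (suc n) + (f ⊛ tail g) n
  ⊛-tailʳ f g zero    = solve 4 (λ a b c d → a :* b :+ c :* d := d :* c :+ a :* b) refl (f 0) (g 1) (f 1) (g 0)
  ⊛-tailʳ f g (suc n) = begin
    f 0 * g (2 ℕ.+ n) + (tail f ⊛ g) (suc n)
      ≈⟨ +-congˡ (⊛-tailʳ (tail f) g n) ⟩
    f 0 * g (2 ℕ.+ n) + (g 0 * f (2 ℕ.+ n) + (tail f ⊛ tail g) n)
      ≈⟨ solve 3 (λ a b c → a :+ (b :+ c) := b :+ (a :+ c)) refl _ _ _ ⟩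
    g 0 * f (2 ℕ.+ n) + (f 0 * g (2 ℕ.+ n) + (tail f ⊛ tail g) n) ∎

  ⊛-comm : ∀ f g → f ⊛ g ≋ g ⊛ f
  ⊛-comm f g zero    = *-comm _ _
  ⊛-comm f g (suc n) = trans (+-congˡ (⊛-comm (tail f) g n)) (sym (⊛-tailʳ g f n))

  ⊛-assoc : ∀ f g h → (f ⊛ g) ⊛ h ≋ f ⊛ (g ⊛ h)
  ⊛-assoc f g h zero    = *-assoc _ _ _
  ⊛-assoc f g h (suc n) = begin
    (f 0 * g 0) * h (suc n) + (tail (f ⊛ g) ⊛ h) n
      ≈⟨ +-congˡ (⊛-cong {tail (f ⊛ g)} {f 0 · tail g ⊕ tail f ⊛ g} (λ _ → refl) ≋-refl n) ⟩
    (f 0 * g 0) * h (suc n) + ((f 0 · tail g ⊕ tail f ⊛ g) ⊛ h) n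
      ≈⟨ +-congˡ (trans (⊛-distribʳ _ _ h n) (+-cong (·-⊛ (f 0) (tail g) h n) (⊛-assoc (tail f) g h n))) ⟩
    (f 0 * g 0) * h (suc n) + (f 0 * (tail g ⊛ h) n + (tail f ⊛ (g ⊛ h)) n)
      ≈⟨ solve 5 (λ a b c d e → a :* b :* c :+ (a :* d :+ e) := a :* (b :* c :+ d) :+ e) refl _ _ _ _ _ ⟩
    f 0 * (g 0 * h (suc n) + (tail g ⊛ h) n) + (tail f ⊛ (g ⊛ h)) n ∎

  commutativeRing : CommutativeRing c ℓ
  commutativeRing = record
    { Carrier = Series ; _≈_ = _≋_ ; _+_ = _⊕_ ; _*_ = _⊛_ ; -_ = ⊝_ ; 0# = 0s ; 1# = 1s
    ; isCommutativeRing = record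
      { isRing = record
        { +-isAbelianGroup = record
          { isGroup = record
            { isMonoid = record
              { isSemigroup = record
                { isMagma = record
                  { isEquivalence = record { refl = ≋-refl ; sym = ≋-sym ; trans = ≋-trans }
                  ; ∙-cong = λ f≋f′ g≋g′ n → +-cong (f≋f′ n) (g≋g′ n) }
                ; assoc = λ f g h n → +-assoc _ _ _ }
              ; identity = (λ f n → +-identityˡ _) , (λ f n → +-identityʳ _) }
            ; inverse = (λ f n → -‿inverseˡ _) , (λ f n → -‿inverseʳ _)
            ; ⁻¹-cong = λ f≋g n → -‿cong (f≋g n) }
          ; comm = λ f g n → +-comm _ _ }
        ; *-cong = ⊛-cong
        ; *-assoc = ⊛-assoc
        ; *-identity = ⊛-identityˡ , ⊛-identityʳ
        ; distrib = ⊛-distribˡ , λ g f f′ → ⊛-distribʳ f f′ g }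
      ; *-comm = ⊛-comm } }

  const-⊛ : ∀ a g → const a ⊛ g ≋ a · g
  const-⊛ a g zero    = refl
  const-⊛ a g (suc n) = trans (+-congˡ (⊛-zeroˡ g n)) (+-identityʳ _)

  ⊛-const : ∀ f a → f ⊛ const a ≋ a · f
  ⊛-const f a = ≋-trans (⊛-comm f (const a)) (const-⊛ a f)

  const-* : ∀ a b → const (a * b) ≋ const a ⊛ const b
  const-* a b zero    = refl
  const-* a b (suc n) = sym (trans (const-⊛ a (const b) (suc n)) (zeroʳ a))

  const-+ : ∀ a b → const (a + b) ≋ const a ⊕ const b
  const-+ a b zero    = refl
  const-+ a b (suc n) = sym (+-identityʳ 0#)

  const-0 : const 0# ≋ 0s
  const-0 zero    = refl
  const-0 (suc n) = refl

  const-homomorphism : rawRing -Raw-AlmostCommutative⟶ fromCommutativeRing commutativeRing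
  const-homomorphism = record
    { ⟦_⟧    = const
    ; +-homo = const-+
    ; *-homo = const-*
    ; -‿homo = λ { a zero → refl ; a (suc n) → sym (trans (sym (+-identityˡ _)) (-‿inverseʳ 0#)) }
    ; 0-homo = const-0
    ; 1-homo = λ _ → refl }

  const-cong : ∀ {a b} → a ≈ b → const a ≋ const b
  const-cong a≈b zero    = a≈b
  const-cong a≈b (suc n) = refl

  shift-cong : ∀ {f g} → f ≋ g → shift f ≋ shift g
  shift-cong f≋g zero    = refl
  shift-cong f≋g (suc n) = f≋g n

  shift-⊛ : ∀ f g → shift f ⊛ g ≋ shift (f ⊛ g)
  shift-⊛ f g zero    = zeroˡ _
  shift-⊛ f g (suc n) = trans (+-congʳ (zeroˡ _)) (+-identityˡ _)

  ⊛-shift : ∀ f g → f ⊛ shift g ≋ shift (f ⊛ g)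
  ⊛-shift f g = ≋-trans (⊛-comm f (shift g)) (≋-trans (shift-⊛ g f) (shift-cong (⊛-comm g f)))

  ⊛-tail : ∀ f g → f ⊛ g ≋ g 0 · f ⊕ shift (f ⊛ tail g)
  ⊛-tail f g zero    = trans (*-comm _ _) (sym (+-identityʳ _))
  ⊛-tail f g (suc n) = ⊛-tailʳ f g n

  ⊛-congʳ-upTo : ∀ f {g g′} n → (∀ m → m ≤ n → g m ≈ g′ m) → (f ⊛ g) n ≈ (f ⊛ g′) n
  ⊛-congʳ-upTo f zero    g≈g′ = *-congˡ (g≈g′ 0 z≤n)
  ⊛-congʳ-upTo f (suc n) g≈g′ =
    +-cong (*-congˡ (g≈g′ (suc n) ℕ.≤-refl)) (⊛-congʳ-upTo (tail f) n (λ m m≤n → g≈g′ m (ℕ.m≤n⇒m≤1+n m≤n)))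

  ⊛-congˡ-upTo : ∀ {f f′} g n → (∀ m → m ≤ n → f m ≈ f′ m) → (f ⊛ g) n ≈ (f′ ⊛ g) n
  ⊛-congˡ-upTo {f} {f′} g n f≈f′ = trans (⊛-comm f g n) (trans (⊛-congʳ-upTo g n f≈f′) (⊛-comm g f′ n))

  coeff-⊛ : ∀ f g n → (f ⊛ g) n ≈ ∑[ j ≤ n ] (f j * g (n ∸ j))
  coeff-⊛ f g zero    = refl
  coeff-⊛ f g (suc n) = trans (+-congˡ (coeff-⊛ (tail f) g n)) (sym (∑≤-suc n (λ j → f j * g (suc n ∸ j))))

  shiftBy : ℕ → Series → Series
  shiftBy zero    f = f
  shiftBy (suc k) f = shift (shiftBy k f)

  shiftBy-cong : ∀ k {f g} → f ≋ g → shiftBy k f ≋ shiftBy k g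
  shiftBy-cong zero    f≋g = f≋g
  shiftBy-cong (suc k) f≋g = shift-cong (shiftBy-cong k f≋g)

  shiftBy-+ : ∀ a b f → shiftBy (a ℕ.+ b) f ≋ shiftBy a (shiftBy b f)
  shiftBy-+ zero    b f = ≋-refl
  shiftBy-+ (suc a) b f = shift-cong (shiftBy-+ a b f)

  shiftBy-⊛ : ∀ k f g → shiftBy k f ⊛ g ≋ shiftBy k (f ⊛ g)
  shiftBy-⊛ zero    f g = ≋-refl
  shiftBy-⊛ (suc k) f g = ≋-trans (shift-⊛ (shiftBy k f) g) (shift-cong (shiftBy-⊛ k f g))

  ⊛-shiftBy : ∀ k f g → f ⊛ shiftBy k g ≋ shiftBy k (f ⊛ g)
  ⊛-shiftBy k f g = ≋-trans (⊛-comm f (shiftBy k g)) (≋-trans (shiftBy-⊛ k g f) (shiftBy-cong k (⊛-comm g f)))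

  shiftBy-< : ∀ k f {n} → n < k → shiftBy k f n ≈ 0#
  shiftBy-< (suc k) f {zero}  _         = refl
  shiftBy-< (suc k) f {suc n} (s≤s n<k) = shiftBy-< k f n<k

  shiftBy-+ˡ : ∀ k f n → shiftBy k f (k ℕ.+ n) ≈ f n
  shiftBy-+ˡ zero    f n = refl
  shiftBy-+ˡ (suc k) f n = shiftBy-+ˡ k f n

  shiftBy-const-≡ : ∀ k a → shiftBy k (const a) k ≈ a
  shiftBy-const-≡ zero    a = refl
  shiftBy-const-≡ (suc k) a = shiftBy-const-≡ k a

  shiftBy-const-≢ : ∀ k a {n} → n ≢ k → shiftBy k (const a) n ≈ 0#
  shiftBy-const-≢ zero    a {zero}  n≢k = ⊥-elim (n≢k ≡.refl)
  shiftBy-const-≢ zero    a {suc n} _   = refl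
  shiftBy-const-≢ (suc k) a {zero}  _   = refl
  shiftBy-const-≢ (suc k) a {suc n} n≢k = shiftBy-const-≢ k a (λ n≡k → n≢k (≡.cong suc n≡k))

  ⊛-cancelʳ : ∀ {f} g → g 0 ≈ 1# → f ⊛ g ≋ 0s → f ≋ 0s
  ⊛-cancelʳ {f} g g0≈1 fg≋0 n = upTo n n ℕ.≤-refl
    where
    step : ∀ n → shift (f ⊛ tail g) n ≈ 0# → f n ≈ 0#
    step n fg′≈0 = begin
      f n                                 ≈⟨ sym (+-identityʳ _) ⟩
      f n + 0#                            ≈⟨ +-cong (sym (trans (*-congʳ g0≈1) (*-identityˡ _))) (sym fg′≈0) ⟩
      g 0 * f n + shift (f ⊛ tail g) n    ≈⟨ sym (⊛-tail f g n) ⟩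
      (f ⊛ g) n                           ≈⟨ fg≋0 n ⟩
      0#                                  ∎
    upTo : ∀ n m → m ≤ n → f m ≈ 0#
    upTo n       zero    _         = step 0 refl
    upTo (suc n) (suc m) (s≤s m≤n) = step (suc m)
      (trans (⊛-congˡ-upTo (tail g) m (λ k k≤m → upTo n k (ℕ.≤-trans k≤m m≤n))) (⊛-zeroˡ (tail g) m))

module TriangularNumbers where

  open import Data.Empty using (⊥-elim)
  open import Data.Nat as ℕ using (ℕ; zero; suc; _+_; _*_; _≤_; _<_; z≤n; s≤s; NonZero)
  open import Data.Nat.DivMod using (_%_; _/_; m≡m%n+[m/n]*n; m%n<n; [m+kn]%n≡m%n; m<n⇒m%n≡m)
  import Data.Nat.Properties as ℕ
  open import Data.Nat.Tactic.RingSolver using (solve-∀)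
  open import Data.Product using (Σ; ∃; _×_; _,_; map₂; proj₁; proj₂)
  open import Data.Sum using (_⊎_; inj₁; inj₂)
  open import Relation.Binary.Definitions using (tri<; tri≈; tri>)
  open import Relation.Binary.PropositionalEquality
  open import Relation.Nullary using (Dec)
  open import Relation.Nullary.Decidable using (map′)

  tri : ℕ → ℕ
  tri zero    = 0
  tri (suc k) = tri k + suc k

  n≤tri : ∀ n → n ≤ tri n
  n≤tri zero    = z≤n
  n≤tri (suc n) = ℕ.m≤n+m (suc n) (tri n)

  tri-< : ∀ {k l} → k < l → tri k < tri l
  tri-< {k} {suc l} (s≤s k≤l) with ℕ.m≤n⇒m<n∨m≡n k≤l
  ... | inj₁ k<l  = ℕ.<-≤-trans (tri-< k<l) (ℕ.m≤m+n (tri l) (suc l))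
  ... | inj₂ refl = ℕ.m<m+n (tri k) (s≤s z≤n)

  tri-injective : ∀ {k l} → tri k ≡ tri l → k ≡ l
  tri-injective {k} {l} eq with ℕ.<-cmp k l
  ... | tri< k<l _ _ = ⊥-elim (ℕ.<⇒≢ (tri-< k<l) eq)
  ... | tri≈ _ k≡l _ = k≡l
  ... | tri> _ _ l<k = ⊥-elim (ℕ.<⇒≢ (tri-< l<k) (sym eq))

  triangular? : ∀ n → Dec (∃ λ k → tri k ≡ n)
  triangular? n = map′ (map₂ λ (_ , e) → e) (λ (k , e) → k , s≤s (subst (k ≤_) e (n≤tri k)) , e)
                       (ℕ.anyUpTo? (λ k → tri k ℕ.≟ n) (suc n))

  divMod : ∀ d .{{_ : NonZero d}} n → Σ ℕ λ K → Σ ℕ λ r → r < d × n ≡ K * d + r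
  divMod d n = n / d , n % d , m%n<n n d , trans (m≡m%n+[m/n]*n n d) (ℕ.+-comm (n % d) _)

  divMod-unique : ∀ d .{{_ : NonZero d}} K L {r s} → r < d → s < d → K * d + r ≡ L * d + s → r ≡ s × K ≡ L
  divMod-unique d K L {r} {s} r<d s<d eq =
    r≡s , ℕ.*-cancelʳ-≡ K L d (ℕ.+-cancelʳ-≡ r (K * d) (L * d) (trans eq (cong (L * d +_) (sym r≡s))))
    where
    r≡s : r ≡ s
    r≡s = begin
      r                  ≡⟨ sym (m<n⇒m%n≡m r<d) ⟩
      r % d              ≡⟨ sym ([m+kn]%n≡m%n r K d) ⟩
      (r + K * d) % d    ≡⟨ cong (_% d) (trans (ℕ.+-comm r (K * d)) (trans eq (ℕ.+-comm (L * d) s))) ⟩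
      (s + L * d) % d    ≡⟨ [m+kn]%n≡m%n s L d ⟩
      s % d              ≡⟨ m<n⇒m%n≡m s<d ⟩
      s                  ∎
      where open ≡-Reasoning

  tri-+ : ∀ m n → tri (m + n) ≡ tri m + tri n + m * n
  tri-+ zero    n = sym (ℕ.+-identityʳ (tri n))
  tri-+ (suc m) n = begin
    tri (m + n) + suc (m + n)                    ≡⟨ cong (_+ suc (m + n)) (tri-+ m n) ⟩
    tri m + tri n + m * n + suc (m + n)          ≡⟨ arith (tri m) (tri n) m n ⟩
    (tri m + suc m) + tri n + suc m * n          ∎
    where
    open ≡-Reasoning
    arith : ∀ a b m n → a + b + m * n + suc (m + n) ≡ (a + suc m) + b + suc m * n
    arith = solve-∀

  tri-3j+1 : ∀ j → tri (j * 3 + 1) ≡ (tri j * 3) * 3 + 1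
  tri-3j+1 zero    = refl
  tri-3j+1 (suc j) = begin
    tri (3 + (j * 3 + 1))                         ≡⟨ tri-+ 3 (j * 3 + 1) ⟩
    6 + tri (j * 3 + 1) + 3 * (j * 3 + 1)         ≡⟨ cong (λ t → 6 + t + 3 * (j * 3 + 1)) (tri-3j+1 j) ⟩
    6 + ((tri j * 3) * 3 + 1) + 3 * (j * 3 + 1)   ≡⟨ arith (tri j) j ⟩
    ((tri j + suc j) * 3) * 3 + 1                 ∎
    where
    open ≡-Reasoning
    arith : ∀ t j → 6 + ((t * 3) * 3 + 1) + 3 * (j * 3 + 1) ≡ ((t + suc j) * 3) * 3 + 1
    arith = solve-∀

  private
    tri-3j+0 : ∀ j → Σ ℕ λ u → tri (j * 3 + 0) ≡ u * 3 + 0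
    tri-3j+0 zero    = 0 , refl
    tri-3j+0 (suc j) with tri-3j+0 j
    ... | u , e = 2 + u + j * 3 , (begin
      tri (3 + (j * 3 + 0))                         ≡⟨ tri-+ 3 (j * 3 + 0) ⟩
      6 + tri (j * 3 + 0) + 3 * (j * 3 + 0)         ≡⟨ cong (λ t → 6 + t + 3 * (j * 3 + 0)) e ⟩
      6 + (u * 3 + 0) + 3 * (j * 3 + 0)             ≡⟨ arith u j ⟩
      (2 + u + j * 3) * 3 + 0                       ∎)
      where
      open ≡-Reasoning
      arith : ∀ u j → 6 + (u * 3 + 0) + 3 * (j * 3 + 0) ≡ (2 + u + j * 3) * 3 + 0
      arith = solve-∀

    tri-3j+2 : ∀ j → tri (j * 3 + 2) ≡ (tri j * 3 + j + 1) * 3 + 0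
    tri-3j+2 j = begin
      tri (j * 3 + 2)                              ≡⟨ cong tri (ℕ.+-suc (j * 3) 1) ⟩
      tri (j * 3 + 1) + suc (j * 3 + 1)            ≡⟨ cong (_+ suc (j * 3 + 1)) (tri-3j+1 j) ⟩
      (tri j * 3) * 3 + 1 + suc (j * 3 + 1)        ≡⟨ arith (tri j) j ⟩
      (tri j * 3 + j + 1) * 3 + 0                  ∎
      where
      open ≡-Reasoning
      arith : ∀ t j → (t * 3) * 3 + 1 + suc (j * 3 + 1) ≡ (t * 3 + j + 1) * 3 + 0
      arith = solve-∀

  tri-mod-3 : ∀ k → (∃ λ u → tri k ≡ u * 3 + 0) ⊎ (∃ λ i → tri k ≡ (tri i * 3) * 3 + 1)
  tri-mod-3 k with divMod 3 k
  ... | j , 0 , _ , refl = inj₁ (tri-3j+0 j)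
  ... | j , 1 , _ , refl = inj₂ (j , tri-3j+1 j)
  ... | j , 2 , _ , refl = inj₁ (tri j * 3 + j + 1 , tri-3j+2 j)
  ... | _ , suc (suc (suc _)) , s≤s (s≤s (s≤s ())) , _

  tri≢3m+2 : ∀ k m → tri k ≢ m * 3 + 2
  tri≢3m+2 k m eq with tri-mod-3 k
  ... | inj₁ (u , e) with () ← proj₁ (divMod-unique 3 u m (s≤s z≤n) (ℕ.n<1+n 2) (trans (sym e) eq))
  ... | inj₂ (i , e) with () ← proj₁ (divMod-unique 3 (tri i * 3) m (s≤s (s≤s z≤n)) (ℕ.n<1+n 2) (trans (sym e) eq))

  tri≡3m+1 : ∀ {k m} → tri k ≡ m * 3 + 1 → ∃ λ i → m ≡ tri i * 3
  tri≡3m+1 {k} {m} eq with tri-mod-3 k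
  ... | inj₁ (u , e) with () ← proj₁ (divMod-unique 3 u m (s≤s z≤n) (s≤s (s≤s z≤n)) (trans (sym e) eq))
  ... | inj₂ (i , e) = i , sym (proj₂ (divMod-unique 3 (tri i * 3) m (s≤s (s≤s z≤n)) (s≤s (s≤s z≤n)) (trans (sym e) eq)))

  tri-9K+3r+1 : ∀ K r → ∃ λ c → tri (K * 9 + (r * 3 + 1)) ≡ c * 27 + tri (r * 3 + 1)
  tri-9K+3r+1 zero    r = 0 , refl
  tri-9K+3r+1 (suc K) r with tri-9K+3r+1 K r
  ... | c , e = c + K * 3 + r + 2 , (begin
    tri (9 + (K * 9 + (r * 3 + 1)))                                  ≡⟨ tri-+ 9 _ ⟩
    45 + tri (K * 9 + (r * 3 + 1)) + 9 * (K * 9 + (r * 3 + 1))       ≡⟨ cong (λ t → 45 + t + 9 * (K * 9 + (r * 3 + 1))) e ⟩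
    45 + (c * 27 + T) + 9 * (K * 9 + (r * 3 + 1))                    ≡⟨ arith c T K r ⟩
    (c + K * 3 + r + 2) * 27 + T                                     ∎)
    where
    open ≡-Reasoning
    T = tri (r * 3 + 1)
    arith : ∀ c T K r → 45 + (c * 27 + T) + 9 * (K * 9 + (r * 3 + 1)) ≡ (c + K * 3 + r + 2) * 27 + T
    arith = solve-∀

module FiniteTripleProduct {c ℓ} (S : CommutativeSemiring c ℓ) (q : CommutativeSemiring.Carrier S) where

  open import Data.List using (_∷_; [])
  open import Data.Nat as ℕ using (ℕ; zero; suc; _≤_; _<_; _∸_; z≤n; s≤s)
  import Data.Nat.Properties as ℕ
  import Data.Nat.Tactic.RingSolver as ℕ-Solver
  open import Data.Product using (Σ; _,_)
  open import Level using (_⊔_)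
  open import Relation.Binary.PropositionalEquality as ≡ using (_≡_)

  open CommutativeSemiring S hiding (zero)
  open import Algebra.Properties.Semiring.Exp semiring using (_^_; ^-homo-*)
  open import Algebra.Solver.Ring.NaturalCoefficients.Default S using (solve; _:=_; _:+_; _:*_; con)
  open import Relation.Binary.Reasoning.Setoid setoid
  open FiniteSums S
  open TriangularNumbers using (tri; n≤tri)

  q^-≡ : ∀ a b c d → a ℕ.+ b ≡ c ℕ.+ d → q ^ a * q ^ b ≈ q ^ c * q ^ d
  q^-≡ a b c d eq = trans (sym (^-homo-* q a b)) (trans (reflexive (≡.cong (q ^_) eq)) (^-homo-* q c d))

  qbinom : ℕ → ℕ → Carrier
  qbinom n       zero    = 1#
  qbinom zero    (suc r) = 0#
  qbinom (suc n) (suc r) = qbinom n r + q ^ suc r * qbinom n (suc r)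

  qbinom-≡ : ∀ {n n′ r r′} → n ≡ n′ → r ≡ r′ → qbinom n r ≈ qbinom n′ r′
  qbinom-≡ n≡n′ r≡r′ = reflexive (≡.cong₂ qbinom n≡n′ r≡r′)

  qbinom-congˡ : ∀ r {n n′} → n ≡ n′ → qbinom n r ≈ qbinom n′ r
  qbinom-congˡ r n≡n′ = reflexive (≡.cong (λ n → qbinom n r) n≡n′)

  n<r⇒qbinom≈0 : ∀ {n r} → n < r → qbinom n r ≈ 0#
  n<r⇒qbinom≈0 {zero}  {suc r} _         = refl
  n<r⇒qbinom≈0 {suc n} {suc r} (s≤s n<r) = begin
    qbinom n r + q ^ suc r * qbinom n (suc r) ≈⟨ +-cong (n<r⇒qbinom≈0 n<r) (*-congˡ (n<r⇒qbinom≈0 (ℕ.m<n⇒m<1+n n<r))) ⟩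
    0# + q ^ suc r * 0#                        ≈⟨ solve 1 (λ x → con 0 :+ x :* con 0 := con 0) refl (q ^ suc r) ⟩
    0#                                         ∎

  qbinom-diag : ∀ n → qbinom n n ≈ 1#
  qbinom-diag zero    = refl
  qbinom-diag (suc n) = begin
    qbinom n n + q ^ suc n * qbinom n (suc n) ≈⟨ +-cong (qbinom-diag n) (*-congˡ (n<r⇒qbinom≈0 (ℕ.n<1+n n))) ⟩
    1# + q ^ suc n * 0#                        ≈⟨ solve 1 (λ x → con 1 :+ x :* con 0 := con 1) refl (q ^ suc n) ⟩
    1#                                         ∎

  qbinom-pascal : ∀ a s → qbinom (suc (s ℕ.+ a)) (suc s) ≈ qbinom (s ℕ.+ a) (suc s) + q ^ a * qbinom (s ℕ.+ a) s
  qbinom-pascal zero s rewrite ℕ.+-identityʳ s = begin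
    qbinom (suc s) (suc s)                    ≈⟨ qbinom-diag (suc s) ⟩
    1#                                         ≈⟨ solve 0 (con 1 := con 0 :+ con 1 :* con 1) refl ⟩
    0# + 1# * 1#                               ≈⟨ sym (+-cong (n<r⇒qbinom≈0 (ℕ.n<1+n s)) (*-congˡ (qbinom-diag s))) ⟩
    qbinom s (suc s) + 1# * qbinom s s         ∎
  qbinom-pascal (suc a) zero = begin
    1# + q ^ 1 * qbinom (suc a) 1              ≈⟨ +-congˡ (*-congˡ (qbinom-pascal a zero)) ⟩
    1# + q ^ 1 * (qbinom a 1 + q ^ a * 1#)     ≈⟨ solve 3 (λ x X A → con 1 :+ (x :* con 1) :* (X :+ A :* con 1)
                                                              := (con 1 :+ (x :* con 1) :* X) :+ (x :* A) :* con 1) refl q (qbinom a 1) (q ^ a) ⟩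
    (1# + q ^ 1 * qbinom a 1) + q ^ suc a * 1# ∎
  qbinom-pascal (suc a) (suc s) = begin
    qbinom (suc m) (suc s) + q ^ suc (suc s) * qbinom (suc m) (suc (suc s))
      ≈⟨ +-cong (qbinom-pascal (suc a) s) (*-congˡ pascal′) ⟩
    (X + q ^ suc a * Y) + q ^ suc (suc s) * (Z + q ^ a * X)
      ≈⟨ solve 6 (λ x X Y Z A S → (X :+ (x :* A) :* Y) :+ (x :* (x :* S)) :* (Z :+ A :* X)
                                   := (X :+ (x :* (x :* S)) :* Z) :+ (x :* A) :* (Y :+ (x :* S) :* X)) refl q X Y Z (q ^ a) (q ^ s) ⟩
    (X + q ^ suc (suc s) * Z) + q ^ suc a * (Y + q ^ suc s * X)
      ∎
    where
    m = s ℕ.+ suc a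
    X = qbinom m (suc s)
    Y = qbinom m s
    Z = qbinom m (suc (suc s))
    e : suc (s ℕ.+ a) ≡ m
    e = ≡.sym (ℕ.+-suc s a)
    pascal′ : qbinom (suc m) (suc (suc s)) ≈ Z + q ^ a * X
    pascal′ = trans (qbinom-congˡ (suc (suc s)) (≡.cong suc (≡.sym e)))
                (trans (qbinom-pascal a (suc s)) (+-cong (qbinom-congˡ (suc (suc s)) e) (*-congˡ (qbinom-congˡ (suc s) e))))

  qbinom-sym : ∀ a b → qbinom (a ℕ.+ b) a ≈ qbinom (a ℕ.+ b) b
  qbinom-sym zero    b       = sym (qbinom-diag b)
  qbinom-sym (suc a) zero    = trans (qbinom-congˡ (suc a) (ℕ.+-identityʳ (suc a))) (qbinom-diag (suc a))
  qbinom-sym (suc a) (suc b) = begin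
    qbinom (a ℕ.+ suc b) a + q ^ suc a * qbinom (a ℕ.+ suc b) (suc a)
      ≈⟨ +-cong (qbinom-sym a (suc b))
                (*-congˡ (trans (qbinom-congˡ (suc a) (≡.sym e₁)) (trans (qbinom-sym (suc a) b) (qbinom-congˡ b e₁)))) ⟩
    qbinom (a ℕ.+ suc b) (suc b) + q ^ suc a * qbinom (a ℕ.+ suc b) b
      ≈⟨ sym (+-cong (qbinom-congˡ (suc b) e₂) (*-congˡ (qbinom-congˡ b e₂))) ⟩
    qbinom (b ℕ.+ suc a) (suc b) + q ^ suc a * qbinom (b ℕ.+ suc a) b
      ≈⟨ sym (qbinom-pascal (suc a) b) ⟩
    qbinom (suc (b ℕ.+ suc a)) (suc b)
      ≈⟨ qbinom-congˡ (suc b) (≡.cong suc e₂) ⟩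
    qbinom (suc (a ℕ.+ suc b)) (suc b)
      ∎
    where
    e₁ : suc (a ℕ.+ b) ≡ a ℕ.+ suc b
    e₁ = ℕ-Solver.solve (a ∷ b ∷ [])
    e₂ : b ℕ.+ suc a ≡ a ℕ.+ suc b
    e₂ = ℕ-Solver.solve (a ∷ b ∷ [])

  qbinom-pascal² : ∀ s d → qbinom (suc (suc (s ℕ.+ d))) (suc (suc s)) ≈
    ((1# + q ^ suc (s ℕ.+ d)) * qbinom (s ℕ.+ d) (suc s) + q ^ suc (suc s) * qbinom (s ℕ.+ d) (suc (suc s)))
      + q ^ d * qbinom (s ℕ.+ d) s
  qbinom-pascal² s zero rewrite ℕ.+-identityʳ s = begin
    qbinom (suc (suc s)) (suc (suc s))
      ≈⟨ qbinom-diag (suc (suc s)) ⟩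
    1#
      ≈⟨ solve 2 (λ x y → con 1 := ((con 1 :+ y) :* con 0 :+ x :* con 0) :+ con 1 :* con 1) refl (q ^ suc (suc s)) (q ^ suc s) ⟩
    ((1# + q ^ suc s) * 0# + q ^ suc (suc s) * 0#) + 1# * 1#
      ≈⟨ sym (+-cong (+-cong (*-congˡ (n<r⇒qbinom≈0 (ℕ.n<1+n s))) (*-congˡ (n<r⇒qbinom≈0 (ℕ.m<n⇒m<1+n (ℕ.n<1+n s)))))
                     (*-congˡ (qbinom-diag s))) ⟩
    ((1# + q ^ suc s) * qbinom s (suc s) + q ^ suc (suc s) * qbinom s (suc (suc s))) + 1# * qbinom s s
      ∎
  qbinom-pascal² s (suc d) = begin
    qbinom (suc n) (suc s) + q ^ suc (suc s) * qbinom (suc n) (suc (suc s))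
      ≈⟨ +-cong (qbinom-pascal (suc d) s) (*-congˡ pascal′) ⟩
    (X + q ^ suc d * Y) + q ^ suc (suc s) * (Z + q ^ d * X)
      ≈⟨ solve 6 (λ x X Y Z D S → (X :+ (x :* D) :* Y) :+ (x :* (x :* S)) :* (Z :+ D :* X)
                                   := ((con 1 :+ x :* (S :* (x :* D))) :* X :+ (x :* (x :* S)) :* Z) :+ (x :* D) :* Y)
                  refl q X Y Z (q ^ d) (q ^ s) ⟩
    ((1# + q * (q ^ s * q ^ suc d)) * X + q ^ suc (suc s) * Z) + q ^ suc d * Y
      ≈⟨ +-congʳ (+-congʳ (*-congʳ (+-congˡ (*-congˡ (sym (^-homo-* q s (suc d))))))) ⟩
    ((1# + q ^ suc n) * X + q ^ suc (suc s) * Z) + q ^ suc d * Y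
      ∎
    where
    n = s ℕ.+ suc d
    X = qbinom n (suc s)
    Y = qbinom n s
    Z = qbinom n (suc (suc s))
    e : suc (s ℕ.+ d) ≡ n
    e = ≡.sym (ℕ.+-suc s d)
    pascal′ : qbinom (suc n) (suc (suc s)) ≈ Z + q ^ d * X
    pascal′ = trans (qbinom-congˡ (suc (suc s)) (≡.cong suc (≡.sym e)))
                (trans (qbinom-pascal d (suc s)) (+-cong (qbinom-congˡ (suc (suc s)) e) (*-congˡ (qbinom-congˡ (suc s) e))))

  qbinom≈1+q* : ∀ r d → Σ Carrier λ V → qbinom (r ℕ.+ d) r ≈ 1# + q * V
  qbinom≈1+q* zero    d = 0# , solve 1 (λ x → con 1 := con 1 :+ x :* con 0) refl q
  qbinom≈1+q* (suc r) d with qbinom≈1+q* r d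
  ... | V , eq = V + q ^ r * qbinom (r ℕ.+ d) (suc r) , (begin
    qbinom (r ℕ.+ d) r + q * q ^ r * qbinom (r ℕ.+ d) (suc r)       ≈⟨ +-congʳ eq ⟩
    (1# + q * V) + q * q ^ r * qbinom (r ℕ.+ d) (suc r)             ≈⟨ solve 4 (λ x v p w → (con 1 :+ x :* v) :+ (x :* p) :* w
                                                                                        := con 1 :+ x :* (v :+ p :* w)) refl q V (q ^ r) _ ⟩
    1# + q * (V + q ^ r * qbinom (r ℕ.+ d) (suc r))                  ∎)

  -- Congruence modulo q^m, phrased without subtraction since S is only a semiring.
  infix 4 _∼_[q^_]
  record _∼_[q^_] (X Y : Carrier) (m : ℕ) : Set (c ⊔ ℓ) where
    constructor witness
    field
      W₁ W₂    : Carrier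
      equation : X + q ^ m * W₁ ≈ Y + q ^ m * W₂

  ≈⇒∼ : ∀ {X Y} m → X ≈ Y → X ∼ Y [q^ m ]
  ≈⇒∼ m X≈Y = witness 0# 0# (+-congʳ X≈Y)

  ∼-sym : ∀ {X Y m} → X ∼ Y [q^ m ] → Y ∼ X [q^ m ]
  ∼-sym (witness W₁ W₂ eq) = witness W₂ W₁ (sym eq)

  ∼-trans : ∀ {X Y Z m} → X ∼ Y [q^ m ] → Y ∼ Z [q^ m ] → X ∼ Z [q^ m ]
  ∼-trans {X} {Y} {Z} {m} (witness W₁ W₂ e) (witness V₁ V₂ f) = witness (W₁ + V₁) (W₂ + V₂) (begin
    X + q ^ m * (W₁ + V₁)            ≈⟨ solve 4 (λ x p w v → x :+ p :* (w :+ v) := (x :+ p :* w) :+ p :* v) refl X (q ^ m) W₁ V₁ ⟩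
    (X + q ^ m * W₁) + q ^ m * V₁    ≈⟨ +-congʳ e ⟩
    (Y + q ^ m * W₂) + q ^ m * V₁    ≈⟨ solve 4 (λ y p w v → (y :+ p :* w) :+ p :* v := (y :+ p :* v) :+ p :* w)
                                               refl Y (q ^ m) W₂ V₁ ⟩
    (Y + q ^ m * V₁) + q ^ m * W₂    ≈⟨ +-congʳ f ⟩
    (Z + q ^ m * V₂) + q ^ m * W₂    ≈⟨ solve 4 (λ z p w v → (z :+ p :* v) :+ p :* w := z :+ p :* (w :+ v)) refl Z (q ^ m) W₂ V₂ ⟩
    Z + q ^ m * (W₂ + V₂)            ∎)

  ∼-weaken : ∀ {X Y m m′} → m ≤ m′ → X ∼ Y [q^ m′ ] → X ∼ Y [q^ m ]
  ∼-weaken {X} {Y} {m} m≤m′ (witness W₁ W₂ eq) with ℕ.m≤n⇒∃[o]m+o≡n m≤m′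
  ... | e , ≡.refl = witness (q ^ e * W₁) (q ^ e * W₂) (begin
    X + q ^ m * (q ^ e * W₁)      ≈⟨ +-congˡ (trans (sym (*-assoc _ _ _)) (*-congʳ (sym (^-homo-* q m e)))) ⟩
    X + q ^ (m ℕ.+ e) * W₁        ≈⟨ eq ⟩
    Y + q ^ (m ℕ.+ e) * W₂        ≈⟨ +-congˡ (trans (*-congʳ (^-homo-* q m e)) (*-assoc _ _ _)) ⟩
    Y + q ^ m * (q ^ e * W₂)      ∎)

  ∼-+ : ∀ {X Y X′ Y′ m} → X ∼ Y [q^ m ] → X′ ∼ Y′ [q^ m ] → X + X′ ∼ Y + Y′ [q^ m ]
  ∼-+ {X} {Y} {X′} {Y′} {m} (witness W₁ W₂ e) (witness V₁ V₂ f) = witness (W₁ + V₁) (W₂ + V₂) (begin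
    (X + X′) + q ^ m * (W₁ + V₁)           ≈⟨ shuffle X X′ W₁ V₁ ⟩
    (X + q ^ m * W₁) + (X′ + q ^ m * V₁)   ≈⟨ +-cong e f ⟩
    (Y + q ^ m * W₂) + (Y′ + q ^ m * V₂)   ≈⟨ sym (shuffle Y Y′ W₂ V₂) ⟩
    (Y + Y′) + q ^ m * (W₂ + V₂)           ∎)
    where
    shuffle : ∀ x x′ w v → (x + x′) + q ^ m * (w + v) ≈ (x + q ^ m * w) + (x′ + q ^ m * v)
    shuffle x x′ w v = solve 5 (λ x x′ p w v → (x :+ x′) :+ p :* (w :+ v) := (x :+ p :* w) :+ (x′ :+ p :* v)) refl x x′ (q ^ m) w v

  ∼-*ˡ : ∀ {X Y m} a → X ∼ Y [q^ m ] → a * X ∼ a * Y [q^ m ]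
  ∼-*ˡ {X} {Y} {m} a (witness W₁ W₂ e) = witness (a * W₁) (a * W₂) (begin
    a * X + q ^ m * (a * W₁)    ≈⟨ factor X W₁ ⟩
    a * (X + q ^ m * W₁)        ≈⟨ *-congˡ e ⟩
    a * (Y + q ^ m * W₂)        ≈⟨ sym (factor Y W₂) ⟩
    a * Y + q ^ m * (a * W₂)    ∎)
    where
    factor : ∀ x w → a * x + q ^ m * (a * w) ≈ a * (x + q ^ m * w)
    factor x w = solve 4 (λ a x p w → a :* x :+ p :* (a :* w) := a :* (x :+ p :* w)) refl a x (q ^ m) w

  ∼-*ʳ : ∀ {X Y m} a → X ∼ Y [q^ m ] → X * a ∼ Y * a [q^ m ]
  ∼-*ʳ a X∼Y = ∼-trans (≈⇒∼ _ (*-comm _ _)) (∼-trans (∼-*ˡ a X∼Y) (≈⇒∼ _ (*-comm _ _)))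

  ∼-q^* : ∀ {X Y m} a → X ∼ Y [q^ m ] → q ^ a * X ∼ q ^ a * Y [q^ a ℕ.+ m ]
  ∼-q^* {X} {Y} {m} a (witness W₁ W₂ e) = witness W₁ W₂ (begin
    q ^ a * X + q ^ (a ℕ.+ m) * W₁     ≈⟨ factor X W₁ ⟩
    q ^ a * (X + q ^ m * W₁)           ≈⟨ *-congˡ e ⟩
    q ^ a * (Y + q ^ m * W₂)           ≈⟨ sym (factor Y W₂) ⟩
    q ^ a * Y + q ^ (a ℕ.+ m) * W₂     ∎)
    where
    factor : ∀ x w → q ^ a * x + q ^ (a ℕ.+ m) * w ≈ q ^ a * (x + q ^ m * w)
    factor x w = trans (+-congˡ (*-congʳ (^-homo-* q a m)))
                   (solve 4 (λ A x p w → A :* x :+ (A :* p) :* w := A :* (x :+ p :* w)) refl (q ^ a) x (q ^ m) w)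

  ∼-∑ : ∀ n {f g m} → (∀ k → k ≤ n → f k ∼ g k [q^ m ]) → ∑≤ n f ∼ ∑≤ n g [q^ m ]
  ∼-∑ zero    f∼g = f∼g 0 z≤n
  ∼-∑ (suc n) f∼g = ∼-+ (∼-∑ n (λ k k≤n → f∼g k (ℕ.m≤n⇒m≤1+n k≤n))) (f∼g (suc n) ℕ.≤-refl)

  qbinom-+-∼ : ∀ j n r → qbinom (j ℕ.+ n) (j ℕ.+ r) ∼ qbinom n r [q^ suc r ]
  qbinom-+-∼ zero    n r = ≈⇒∼ _ refl
  qbinom-+-∼ (suc j) n r = ∼-trans step (qbinom-+-∼ j n r)
    where
    X = qbinom (j ℕ.+ n) (j ℕ.+ r)
    W = qbinom (j ℕ.+ n) (suc (j ℕ.+ r))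
    step : X + q ^ suc (j ℕ.+ r) * W ∼ X [q^ suc r ]
    split-power : q ^ suc (j ℕ.+ r) ≈ q ^ suc r * q ^ j
    split-power = trans (reflexive (≡.cong (q ^_) (≡.cong suc (ℕ.+-comm j r)))) (^-homo-* q (suc r) j)
    step = witness 0# (q ^ j * W) (begin
      (X + q ^ suc (j ℕ.+ r) * W) + q ^ suc r * 0#   ≈⟨ +-cong (+-congˡ (*-congʳ split-power)) (zeroʳ _) ⟩
      (X + q ^ suc r * q ^ j * W) + 0#               ≈⟨ trans (+-identityʳ _) (+-congˡ (*-assoc _ _ _)) ⟩
      X + q ^ suc r * (q ^ j * W)                    ∎)

  qbinom-+ˡ-∼ : ∀ j a s → qbinom (j ℕ.+ (s ℕ.+ a)) (suc s) ∼ qbinom (s ℕ.+ a) (suc s) [q^ a ]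
  qbinom-+ˡ-∼ zero    a s = ≈⇒∼ _ refl
  qbinom-+ˡ-∼ (suc j) a s = ∼-trans step (qbinom-+ˡ-∼ j a s)
    where
    e : s ℕ.+ (j ℕ.+ a) ≡ j ℕ.+ (s ℕ.+ a)
    e = ℕ-Solver.solve (s ∷ j ∷ a ∷ [])
    X = qbinom (j ℕ.+ (s ℕ.+ a)) (suc s)
    W = qbinom (j ℕ.+ (s ℕ.+ a)) s
    step : qbinom (suc (j ℕ.+ (s ℕ.+ a))) (suc s) ∼ X [q^ a ]
    step = witness 0# (q ^ j * W) (begin
      qbinom (suc (j ℕ.+ (s ℕ.+ a))) (suc s) + q ^ a * 0#
        ≈⟨ trans (+-congˡ (zeroʳ _)) (+-identityʳ _) ⟩
      qbinom (suc (j ℕ.+ (s ℕ.+ a))) (suc s)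
        ≈⟨ qbinom-congˡ (suc s) (≡.cong suc (≡.sym e)) ⟩
      qbinom (suc (s ℕ.+ (j ℕ.+ a))) (suc s)
        ≈⟨ qbinom-pascal (j ℕ.+ a) s ⟩
      qbinom (s ℕ.+ (j ℕ.+ a)) (suc s) + q ^ (j ℕ.+ a) * qbinom (s ℕ.+ (j ℕ.+ a)) s
        ≈⟨ +-cong (qbinom-congˡ (suc s) e)
                  (*-cong (trans (reflexive (≡.cong (q ^_) (ℕ.+-comm j a))) (^-homo-* q a j)) (qbinom-congˡ s e)) ⟩
      X + (q ^ a * q ^ j) * W
        ≈⟨ +-congˡ (*-assoc _ _ _) ⟩
      X + q ^ a * (q ^ j * W)
        ∎)

  qbinom-central-∼ : ∀ k e → let N = k ℕ.+ e in
    qbinom (suc (N ℕ.+ N)) (suc (N ℕ.+ k)) ∼ qbinom (suc (N ℕ.+ N)) (suc (N ℕ.+ 0)) [q^ suc e ]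
  qbinom-central-∼ k e =
    ∼-trans (≈⇒∼ _ (qbinom-≡ e₁ e₂))
    (∼-trans (∼-weaken (s≤s (ℕ.≤-trans (ℕ.m≤n+m e k) (ℕ.n≤1+n _))) (qbinom-+-∼ k (suc (N ℕ.+ e)) (suc N)))
    (∼-trans (≈⇒∼ _ (qbinom-congˡ (suc N) (≡.sym (ℕ.+-suc N e))))
    (∼-trans (∼-sym (qbinom-+ˡ-∼ k (suc e) N))
    (≈⇒∼ _ (qbinom-≡ e₃ (≡.cong suc (≡.sym (ℕ.+-identityʳ N))))))))
    where
    N = k ℕ.+ e
    e₁ : suc ((k ℕ.+ e) ℕ.+ (k ℕ.+ e)) ≡ k ℕ.+ suc ((k ℕ.+ e) ℕ.+ e)
    e₁ = ℕ-Solver.solve (k ∷ e ∷ [])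
    e₂ : suc ((k ℕ.+ e) ℕ.+ k) ≡ k ℕ.+ suc (k ℕ.+ e)
    e₂ = ℕ-Solver.solve (k ∷ e ∷ [])
    e₃ : k ℕ.+ ((k ℕ.+ e) ℕ.+ suc e) ≡ suc ((k ℕ.+ e) ℕ.+ (k ℕ.+ e))
    e₃ = ℕ-Solver.solve (k ∷ e ∷ [])

  -- The recurrences of the Morgan–Voyce polynomials b k = Σ_t C(k+t, 2t) zᵗ.
  module ProductExpansion (z : Carrier) (b : ℕ → Carrier) (b-0 : b 0 ≈ 1#) (b-1 : b 1 ≈ 1# + z)
           (b-rec : ∀ k → b (suc (suc k)) + b k ≈ (z + (1# + 1#)) * b (suc k)) where

    factor : ℕ → Carrier
    factor m = (1# + q ^ m) * (1# + q ^ m) + z * q ^ m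

    Π : ℕ → Carrier
    Π zero    = 1#
    Π (suc N) = Π N * factor (suc N)

    B : ℕ → ℕ → Carrier
    B N k = qbinom (suc (N ℕ.+ N)) (suc (N ℕ.+ k))

    term : ℕ → ℕ → Carrier
    term N k = q ^ tri k * (B N k * b k)

    b⁻ : ℕ → Carrier
    b⁻ zero    = b 0
    b⁻ (suc k) = b k

    b-rec′ : ∀ k → (z + (1# + 1#)) * b k ≈ b (suc k) + b⁻ k
    b-rec′ zero    = begin
      (z + (1# + 1#)) * b 0   ≈⟨ *-congˡ b-0 ⟩
      (z + (1# + 1#)) * 1#    ≈⟨ solve 1 (λ z → (z :+ (con 1 :+ con 1)) :* con 1 := (con 1 :+ z) :+ con 1) refl z ⟩
      (1# + z) + 1#           ≈⟨ sym (+-cong b-1 b-0) ⟩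
      b 1 + b 0               ∎
    b-rec′ (suc k) = sym (b-rec k)

    N<k⇒B≈0 : ∀ {N k} → N < k → B N k ≈ 0#
    N<k⇒B≈0 {N} N<k = n<r⇒qbinom≈0 (s≤s (ℕ.+-monoʳ-< N N<k))

    private
      a*[c*[0*d]]≈0 : ∀ a c {u} d → u ≈ 0# → a * (c * (u * d)) ≈ 0#
      a*[c*[0*d]]≈0 a c d u≈0 = trans (*-congˡ (*-congˡ (trans (*-congʳ u≈0) (zeroˡ d)))) (trans (*-congˡ (zeroʳ c)) (zeroʳ a))

    -- The induction step N ↦ N+1: each term splits into three pieces (A, E, F) after
    -- multiplying by the new factor, and the q-Pascal rule reassembles them.
    module Step (N : ℕ) where
      x : Carrier
      x = q ^ suc N

      A E F C D : ℕ → Carrier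
      A k = q ^ tri k * ((1# + x * x) * (B N k * b k))
      E k = x * (q ^ tri k * (B N k * b (suc k)))
      F k = x * (q ^ tri k * (B N k * b⁻ k))
      C zero    = F 0
      C (suc j) = E j
      D k = F (suc k)

      split : ∀ k → term N k * factor (suc N) ≈ A k + (E k + F k)
      split k = begin
        q ^ tri k * (B N k * b k) * ((1# + x) * (1# + x) + z * x)
          ≈⟨ solve 5 (λ T u p x z → (T :* (u :* p)) :* ((con 1 :+ x) :* (con 1 :+ x) :+ z :* x)
                                    := T :* ((con 1 :+ x :* x) :* (u :* p)) :+ x :* (T :* (u :* ((z :+ (con 1 :+ con 1)) :* p))))
                     refl (q ^ tri k) (B N k) (b k) x z ⟩
        A k + x * (q ^ tri k * (B N k * ((z + (1# + 1#)) * b k)))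
          ≈⟨ +-congˡ (*-congˡ (*-congˡ (*-congˡ (b-rec′ k)))) ⟩
        A k + x * (q ^ tri k * (B N k * (b (suc k) + b⁻ k)))
          ≈⟨ +-congˡ (solve 5 (λ x T u p m → x :* (T :* (u :* (p :+ m))) := x :* (T :* (u :* p)) :+ x :* (T :* (u :* m)))
                              refl x (q ^ tri k) (B N k) (b (suc k)) (b⁻ k)) ⟩
        A k + (E k + F k)
          ∎

      n′ : ℕ
      n′ = suc (N ℕ.+ N)

      C-lem : ∀ k → k ≤ suc N → q ^ tri k * (q ^ (suc N ∸ k) * (qbinom n′ (N ℕ.+ k) * b k)) ≈ C k
      C-lem zero    _         = begin
        q ^ 0 * (x * (qbinom n′ (N ℕ.+ 0) * b 0))   ≈⟨ *-congˡ (*-congˡ (*-congʳ symmetric)) ⟩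
        q ^ 0 * (x * (B N 0 * b 0))                 ≈⟨ solve 3 (λ x u p → con 1 :* (x :* (u :* p)) := x :* (con 1 :* (u :* p)))
                                                                 refl x (B N 0) (b 0) ⟩
        C 0                                          ∎
        where
        symmetric : qbinom n′ (N ℕ.+ 0) ≈ B N 0
        symmetric = begin
          qbinom n′ (N ℕ.+ 0)          ≈⟨ reflexive (≡.cong (qbinom n′) (ℕ.+-identityʳ N)) ⟩
          qbinom n′ N                  ≈⟨ qbinom-congˡ N (ℕ.+-suc N N) ⟨
          qbinom (N ℕ.+ suc N) N       ≈⟨ qbinom-sym N (suc N) ⟩
          qbinom (N ℕ.+ suc N) (suc N) ≈⟨ qbinom-≡ (ℕ.+-suc N N) (≡.cong suc (≡.sym (ℕ.+-identityʳ N))) ⟩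
          B N 0                        ∎
      C-lem (suc j) (s≤s j≤N) = begin
        q ^ tri (suc j) * (q ^ (N ∸ j) * (qbinom n′ (N ℕ.+ suc j) * b (suc j)))
          ≈⟨ sym (*-assoc _ _ _) ⟩
        (q ^ tri (suc j) * q ^ (N ∸ j)) * (qbinom n′ (N ℕ.+ suc j) * b (suc j))
          ≈⟨ *-cong (q^-≡ (tri (suc j)) (N ∸ j) (suc N) (tri j) exponents) (*-congʳ (reflexive (≡.cong (qbinom n′) (ℕ.+-suc N j)))) ⟩
        (x * q ^ tri j) * (B N j * b (suc j))
          ≈⟨ *-assoc _ _ _ ⟩
        C (suc j)
          ∎
        where
        exponents : tri (suc j) ℕ.+ (N ∸ j) ≡ suc N ℕ.+ tri j
        exponents = ≡.trans (ℕ.+-assoc (tri j) (suc j) (N ∸ j))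
                      (≡.trans (≡.cong (λ w → tri j ℕ.+ suc w) (ℕ.m+[n∸m]≡n j≤N)) (ℕ.+-comm (tri j) (suc N)))

      D-lem : ∀ k → q ^ tri k * (q ^ suc (suc (N ℕ.+ k)) * (B N (suc k) * b k)) ≈ D k
      D-lem k = trans (sym (*-assoc _ _ _))
                  (trans (*-congʳ (q^-≡ (tri k) (suc (suc (N ℕ.+ k))) (suc N) (tri (suc k)) exponents)) (*-assoc _ _ _))
        where
        exponents : tri k ℕ.+ suc (suc (N ℕ.+ k)) ≡ suc N ℕ.+ (tri k ℕ.+ suc k)
        exponents = arith (tri k) N k
          where
          arith : ∀ t N k → t ℕ.+ suc (suc (N ℕ.+ k)) ≡ suc N ℕ.+ (t ℕ.+ suc k)
          arith = ℕ-Solver.solve-∀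

      decomp : ∀ k → k ≤ suc N → term (suc N) k ≈ A k + (C k + D k)
      decomp k k≤ = begin
        q ^ tri k * (qbinom (suc (suc (N ℕ.+ suc N))) (suc (suc s)) * b k)
          ≈⟨ *-congˡ (*-congʳ (trans (qbinom-congˡ (suc (suc s)) (≡.cong (λ w → suc (suc w)) (≡.sym s+d≡)))
                                     (qbinom-pascal² s d))) ⟩
        q ^ tri k * ((((1# + q ^ suc (s ℕ.+ d)) * qbinom (s ℕ.+ d) (suc s)
                       + q ^ suc (suc s) * qbinom (s ℕ.+ d) (suc (suc s))) + q ^ d * qbinom (s ℕ.+ d) s) * b k)
          ≈⟨ *-congˡ (*-congʳ (+-cong (+-cong (*-cong (+-congˡ x*x) (qbinom-congˡ (suc s) s+d≡′))
                                              (*-congˡ (qbinom-≡ s+d≡′ (≡.cong suc (≡.sym (ℕ.+-suc N k))))))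
                                       (*-congˡ (qbinom-congˡ s s+d≡′)))) ⟩
        q ^ tri k * ((((1# + x * x) * B N k + q ^ suc (suc s) * B N (suc k)) + q ^ d * qbinom n′ s) * b k)
          ≈⟨ solve 8 (λ T y u u′ p₂ p₃ w p → T :* ((((con 1 :+ y) :* u :+ p₂ :* u′) :+ p₃ :* w) :* p)
                                            := T :* ((con 1 :+ y) :* (u :* p)) :+ (T :* (p₃ :* (w :* p)) :+ T :* (p₂ :* (u′ :* p))))
                     refl (q ^ tri k) (x * x) (B N k) (B N (suc k)) (q ^ suc (suc s)) (q ^ d) (qbinom n′ s) (b k) ⟩
        A k + (q ^ tri k * (q ^ d * (qbinom n′ s * b k)) + q ^ tri k * (q ^ suc (suc s) * (B N (suc k) * b k)))
          ≈⟨ +-congˡ (+-cong (C-lem k k≤) (D-lem k)) ⟩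
        A k + (C k + D k)
          ∎
        where
        s = N ℕ.+ k
        d = suc N ∸ k
        s+d≡ : s ℕ.+ d ≡ N ℕ.+ suc N
        s+d≡ = ≡.trans (ℕ.+-assoc N k d) (≡.cong (N ℕ.+_) (ℕ.m+[n∸m]≡n k≤))
        s+d≡′ : s ℕ.+ d ≡ n′
        s+d≡′ = ≡.trans s+d≡ (ℕ.+-suc N N)
        x*x : q ^ suc (s ℕ.+ d) ≈ x * x
        x*x = trans (reflexive (≡.cong (λ w → q ^ suc w) s+d≡)) (^-homo-* q (suc N) (suc N))

      sum-regroup : ∑≤ N A + (∑≤ N E + ∑≤ N F) ≈ ∑≤ (suc N) A + (∑≤ (suc N) C + ∑≤ (suc N) D)
      sum-regroup = begin
        ∑≤ N A + (∑≤ N E + ∑≤ N F)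
          ≈⟨ +-cong (sym (drop-last {N} A A-top≈0)) (+-congˡ F-split) ⟩
        ∑≤ (suc N) A + (∑≤ N E + (F 0 + ∑≤ (suc N) D))
          ≈⟨ +-congˡ (solve 3 (λ e f d → e :+ (f :+ d) := (f :+ e) :+ d) refl (∑≤ N E) (F 0) (∑≤ (suc N) D)) ⟩
        ∑≤ (suc N) A + ((F 0 + ∑≤ N E) + ∑≤ (suc N) D)
          ≈⟨ +-congˡ (+-congʳ (sym (∑≤-suc N C))) ⟩
        ∑≤ (suc N) A + (∑≤ (suc N) C + ∑≤ (suc N) D)
          ∎
        where
        drop-last : ∀ {n} f → f (suc n) ≈ 0# → ∑≤ (suc n) f ≈ ∑≤ n f
        drop-last f f≈0 = trans (+-congˡ f≈0) (+-identityʳ _)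
        A-top≈0 : A (suc N) ≈ 0#
        A-top≈0 = a*[c*[0*d]]≈0 _ _ _ (N<k⇒B≈0 {N} ℕ.≤-refl)
        F-split : ∑≤ N F ≈ F 0 + ∑≤ (suc N) D
        F-split = begin
          ∑≤ N F                     ≈⟨ drop-last {N} F (a*[c*[0*d]]≈0 _ _ _ (N<k⇒B≈0 {N} ℕ.≤-refl)) ⟨
          ∑≤ (suc N) F               ≈⟨ ∑≤-suc N F ⟩
          F 0 + ∑≤ N D               ≈⟨ +-congˡ (drop-last {N} D (a*[c*[0*d]]≈0 _ _ _ (N<k⇒B≈0 {N} (ℕ.m<n⇒m<1+n (ℕ.n<1+n N))))) ⟨
          F 0 + ∑≤ (suc N) D         ∎

    product-expansion : ∀ N → Π N ≈ ∑[ k ≤ N ] term N k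
    product-expansion zero    = begin
      1#                     ≈⟨ solve 0 (con 1 := con 1 :* (con 1 :* con 1)) refl ⟩
      1# * (1# * 1#)         ≈⟨ sym (*-congˡ (*-cong (qbinom-diag 1) b-0)) ⟩
      q ^ 0 * (B 0 0 * b 0)  ∎
    product-expansion (suc N) = begin
      Π N * factor (suc N)                           ≈⟨ *-congʳ (product-expansion N) ⟩
      ∑≤ N (term N) * factor (suc N)                 ≈⟨ ∑≤-distribʳ-* N (term N) _ ⟩
      ∑[ k ≤ N ] (term N k * factor (suc N))         ≈⟨ ∑≤-cong N (λ k _ → split k) ⟩
      ∑[ k ≤ N ] (A k + (E k + F k))                 ≈⟨ trans (∑≤-distrib-+ N A _) (+-congˡ (∑≤-distrib-+ N E F)) ⟩
      ∑≤ N A + (∑≤ N E + ∑≤ N F)                     ≈⟨ sum-regroup ⟩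
      ∑≤ (suc N) A + (∑≤ (suc N) C + ∑≤ (suc N) D)   ≈⟨ trans (∑≤-distrib-+ (suc N) A _) (+-congˡ (∑≤-distrib-+ (suc N) C D)) ⟨
      ∑[ k ≤ suc N ] (A k + (C k + D k))             ≈⟨ ∑≤-cong (suc N) (λ k k≤ → decomp k k≤) ⟨
      ∑≤ (suc N) (term (suc N))                      ∎
      where open Step N

    product-expansion-∼ : ∀ N → Π N ∼ B N 0 * ∑[ k ≤ N ] (q ^ tri k * b k) [q^ suc N ]
    product-expansion-∼ N =
      ∼-trans (≈⇒∼ _ (product-expansion N)) (∼-trans (∼-∑ N termwise) (≈⇒∼ _ pull-out))
      where
      termwise : ∀ k → k ≤ N → term N k ∼ q ^ tri k * (B N 0 * b k) [q^ suc N ]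
      termwise k k≤N with ℕ.m≤n⇒∃[o]m+o≡n k≤N
      ... | e , ≡.refl = ∼-weaken (ℕ.≤-trans (ℕ.≤-reflexive (≡.sym (ℕ.+-suc k e))) (ℕ.+-monoˡ-≤ (suc e) (n≤tri k)))
                           (∼-q^* (tri k) (∼-*ʳ (b k) (qbinom-central-∼ k e)))
      pull-out : ∑[ k ≤ N ] (q ^ tri k * (B N 0 * b k)) ≈ B N 0 * ∑[ k ≤ N ] (q ^ tri k * b k)
      pull-out = trans (∑≤-cong N (λ k _ → solve 3 (λ a u c → a :* (u :* c) := u :* (a :* c)) refl (q ^ tri k) (B N 0) (b k)))
                       (sym (∑≤-distribˡ-* N _ (B N 0)))

module SeriesMod3 where

  open import Data.Nat as ℕ using (ℕ; zero; suc; _+_; _*_; _<_; s≤s)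
  import Data.Nat.Properties as ℕ
  open import Relation.Binary.PropositionalEquality

  open Mod3
  open PowerSeries 𝔽₃-commutativeRing public
  open 𝔽₃-AlgebraSolver commutativeRing const-homomorphism using (solve; _:=_; _:+_; _:*_; con)

  open CommutativeRing 𝔽₃-commutativeRing using (+-identityʳ) renaming (zeroʳ to *-zeroʳ)

  σ₃ : Series → Series
  σ₃ f zero                = f 0
  σ₃ f (suc zero)          = 0₃
  σ₃ f (suc (suc zero))    = 0₃
  σ₃ f (suc (suc (suc n))) = σ₃ (tail f) n

  σ₃-cong : ∀ {f g} → f ≋ g → σ₃ f ≋ σ₃ g
  σ₃-cong f≋g zero                = f≋g 0
  σ₃-cong f≋g (suc zero)          = refl
  σ₃-cong f≋g (suc (suc zero))    = refl
  σ₃-cong f≋g (suc (suc (suc n))) = σ₃-cong (λ m → f≋g (suc m)) n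

  σ₃-⊕ : ∀ f g → σ₃ (f ⊕ g) ≋ σ₃ f ⊕ σ₃ g
  σ₃-⊕ f g zero                = refl
  σ₃-⊕ f g (suc zero)          = refl
  σ₃-⊕ f g (suc (suc zero))    = refl
  σ₃-⊕ f g (suc (suc (suc n))) = σ₃-⊕ (tail f) (tail g) n

  σ₃-· : ∀ a f → σ₃ (a · f) ≋ a · σ₃ f
  σ₃-· a f zero                = refl
  σ₃-· a f (suc zero)          = sym (*-zeroʳ a)
  σ₃-· a f (suc (suc zero))    = sym (*-zeroʳ a)
  σ₃-· a f (suc (suc (suc n))) = σ₃-· a (tail f) n

  σ₃-⊛ : ∀ f g → σ₃ (f ⊛ g) ≋ σ₃ f ⊛ σ₃ g
  σ₃-⊛ f g zero                = refl
  σ₃-⊛ f g (suc zero)          = sym (cong (_+₃ 0₃ *₃ g 0) (*-zeroʳ (f 0)))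
  σ₃-⊛ f g (suc (suc zero))    = sym (cong (_+₃ 0₃) (*-zeroʳ (f 0)))
  σ₃-⊛ f g (suc (suc (suc n))) = begin
    σ₃ (f 0 · tail g ⊕ tail f ⊛ g) n               ≡⟨ σ₃-⊕ (f 0 · tail g) (tail f ⊛ g) n ⟩
    σ₃ (f 0 · tail g) n +₃ σ₃ (tail f ⊛ g) n       ≡⟨ cong₂ _+₃_ (σ₃-· (f 0) (tail g) n) (σ₃-⊛ (tail f) g n) ⟩
    f 0 *₃ σ₃ (tail g) n +₃ (σ₃ (tail f) ⊛ σ₃ g) n ∎
    where open ≡-Reasoning

  σ₃-coeff₀ : ∀ f j → σ₃ f (j * 3 + 0) ≡ f j
  σ₃-coeff₀ f zero    = refl
  σ₃-coeff₀ f (suc j) = σ₃-coeff₀ (tail f) j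

  σ₃-coeff₁ : ∀ f j → σ₃ f (j * 3 + 1) ≡ 0₃
  σ₃-coeff₁ f zero    = refl
  σ₃-coeff₁ f (suc j) = σ₃-coeff₁ (tail f) j

  σ₃-coeff₂ : ∀ f j → σ₃ f (j * 3 + 2) ≡ 0₃
  σ₃-coeff₂ f zero    = refl
  σ₃-coeff₂ f (suc j) = σ₃-coeff₂ (tail f) j

  cube : Series → Series
  cube f = f ⊛ f ⊛ f

  cube-cong : ∀ {f g} → f ≋ g → cube f ≋ cube g
  cube-cong f≋g = ⊛-cong (⊛-cong f≋g f≋g) f≋g

  -- Frobenius: in characteristic 3, f ↦ f³ is additive and fixes 𝔽₃, so f(q)³ = f(q³).
  frobenius : ∀ f → cube f ≋ σ₃ f
  frobenius f n = trans (split n) (coefficient n)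
    where
    split : cube f ≋ const (f 0) ⊕ shiftBy 3 (cube (tail f))
    split = ≋-trans (cube-cong head+tail)
           (≋-trans (solve 2 (λ u v → (u :+ v) :* (u :+ v) :* (u :+ v) := u :* u :* u :+ v :* v :* v) ≋-refl (const (f 0)) (shift (tail f)))
           (λ n → cong₂ _+₃_ (cube-const n) (cube-shift n)))
      where
      head+tail : f ≋ const (f 0) ⊕ shift (tail f)
      head+tail zero    = sym (+-identityʳ (f 0))
      head+tail (suc n) = refl
      cube-const : cube (const (f 0)) ≋ const (f 0)
      cube-const = ≋-trans (⊛-cong (≋-sym (const-* (f 0) (f 0))) ≋-refl)
                   (≋-trans (≋-sym (const-* (f 0 *₃ f 0) (f 0))) (const-cong (cube-id (f 0))))
      shift-² : ∀ g h → shift g ⊛ shift h ≋ shiftBy 2 (g ⊛ h)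
      shift-² g h = ≋-trans (shift-⊛ g (shift h)) (shift-cong (⊛-shift g h))
      cube-shift : cube (shift (tail f)) ≋ shiftBy 3 (cube (tail f))
      cube-shift = ≋-trans (⊛-cong (shift-² (tail f) (tail f)) ≋-refl)
                   (≋-trans (shiftBy-⊛ 2 _ (shift (tail f))) (shiftBy-cong 2 (⊛-shift (tail f ⊛ tail f) (tail f))))
    coefficient : ∀ n → (const (f 0) ⊕ shiftBy 3 (cube (tail f))) n ≡ σ₃ f n
    coefficient zero                = +-identityʳ (f 0)
    coefficient (suc zero)          = refl
    coefficient (suc (suc zero))    = refl
    coefficient (suc (suc (suc n))) = frobenius (tail f) n

  section : ℕ → Series → Series
  section r f m = f (m * 3 + r)

  section-cong : ∀ r {f g} → f ≋ g → section r f ≋ section r g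
  section-cong r f≋g m = f≋g (m * 3 + r)

  section-shiftBy3 : ∀ {r} → r < 3 → ∀ h → section r (shiftBy 3 h) ≋ shift (section r h)
  section-shiftBy3 {0} _ h zero    = refl
  section-shiftBy3 {1} _ h zero    = refl
  section-shiftBy3 {2} _ h zero    = refl
  section-shiftBy3 {suc (suc (suc _))} (s≤s (s≤s (s≤s ()))) h zero
  section-shiftBy3     _ h (suc m) = refl

  σ₃-head : ∀ g → σ₃ g ≋ const (g 0) ⊕ shiftBy 3 (σ₃ (tail g))
  σ₃-head g zero                = sym (+-identityʳ _)
  σ₃-head g (suc zero)          = refl
  σ₃-head g (suc (suc zero))    = refl
  σ₃-head g (suc (suc (suc n))) = refl

  section-⊛σ₃ : ∀ {r} → r < 3 → ∀ f g → section r (f ⊛ σ₃ g) ≋ section r f ⊛ g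
  section-⊛σ₃ {r} r<3 f g m = begin
    section r (f ⊛ σ₃ g) m
      ≡⟨ section-cong r (⊛-cong ≋-refl (σ₃-head g)) m ⟩
    section r (f ⊛ (const (g 0) ⊕ shiftBy 3 (σ₃ (tail g)))) m
      ≡⟨ section-cong r (≋-trans (⊛-distribˡ f _ _)
                                 (λ n → cong₂ _+₃_ (⊛-const f (g 0) n) (⊛-shiftBy 3 f (σ₃ (tail g)) n))) m ⟩
    g 0 *₃ section r f m +₃ section r (shiftBy 3 (f ⊛ σ₃ (tail g))) m
      ≡⟨ cong (g 0 *₃ section r f m +₃_) (trans (section-shiftBy3 r<3 _ m) (shifted m)) ⟩
    g 0 *₃ section r f m +₃ shift (section r f ⊛ tail g) m
      ≡⟨ ⊛-tail (section r f) g m ⟨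
    (section r f ⊛ g) m
      ∎
    where
    open ≡-Reasoning
    shifted : ∀ m → shift (section r (f ⊛ σ₃ (tail g))) m ≡ shift (section r f ⊛ tail g) m
    shifted zero    = refl
    shifted (suc m) = section-⊛σ₃ r<3 f (tail g) m

  σ₃-0s : σ₃ 0s ≋ 0s
  σ₃-0s zero                = refl
  σ₃-0s (suc zero)          = refl
  σ₃-0s (suc (suc zero))    = refl
  σ₃-0s (suc (suc (suc n))) = σ₃-0s n

  q : Series
  q = shift 1s

  q-⊛ : ∀ h → q ⊛ h ≋ shift h
  q-⊛ h = ≋-trans (shift-⊛ 1s h) (shift-cong (⊛-identityˡ h))

  q-⊛-q-⊛ : ∀ h → q ⊛ (q ⊛ h) ≋ shiftBy 2 h
  q-⊛-q-⊛ h = ≋-trans (q-⊛ (q ⊛ h)) (shift-cong (q-⊛ h))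

  private
    shiftσ₃-3+ : ∀ v n → shift (σ₃ v) (3 + n) ≡ shift (σ₃ (tail v)) n
    shiftσ₃-3+ v zero    = refl
    shiftσ₃-3+ v (suc n) = refl

    shift²σ₃-3+ : ∀ w n → shiftBy 2 (σ₃ w) (3 + n) ≡ shiftBy 2 (σ₃ (tail w)) n
    shift²σ₃-3+ w zero          = refl
    shift²σ₃-3+ w (suc zero)    = refl
    shift²σ₃-3+ w (suc (suc n)) = refl

    trisection′ : ∀ f → f ≋ σ₃ (section 0 f) ⊕ shift (σ₃ (section 1 f)) ⊕ shiftBy 2 (σ₃ (section 2 f))
    trisection′ f zero                = sym (trans (+-identityʳ _) (+-identityʳ _))
    trisection′ f (suc zero)          = sym (+-identityʳ _)
    trisection′ f (suc (suc zero))    = refl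
    trisection′ f (suc (suc (suc n))) = trans (trisection′ (λ k → f (3 + k)) n)
      (cong₂ _+₃_ (cong (σ₃ (tail (section 0 f)) n +₃_) (sym (shiftσ₃-3+ (section 1 f) n))) (sym (shift²σ₃-3+ (section 2 f) n)))

    section₂-σ₃ : ∀ u → section 2 (σ₃ u) ≋ 0s
    section₂-σ₃ u zero    = refl
    section₂-σ₃ u (suc m) = section₂-σ₃ (tail u) m

    section₂-shiftσ₃ : ∀ u → section 2 (shift (σ₃ u)) ≋ 0s
    section₂-shiftσ₃ u zero    = refl
    section₂-shiftσ₃ u (suc m) = trans (shiftσ₃-3+ u (m * 3 + 2)) (section₂-shiftσ₃ (tail u) m)

    section₂-shift²σ₃ : ∀ u → section 2 (shiftBy 2 (σ₃ u)) ≋ u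
    section₂-shift²σ₃ u zero    = refl
    section₂-shift²σ₃ u (suc m) = trans (shift²σ₃-3+ u (m * 3 + 2)) (section₂-shift²σ₃ (tail u) m)

  trisection : ∀ f → f ≋ σ₃ (section 0 f) ⊕ q ⊛ σ₃ (section 1 f) ⊕ q ⊛ (q ⊛ σ₃ (section 2 f))
  trisection f = ≋-trans (trisection′ f) (λ n → sym (cong₂ _+₃_ (cong (σ₃ (section 0 f) n +₃_) (q-⊛ _ n)) (q-⊛-q-⊛ _ n)))

  section₂-trisection : ∀ u v w → section 2 (σ₃ u ⊕ q ⊛ σ₃ v ⊕ q ⊛ (q ⊛ σ₃ w)) ≋ w
  section₂-trisection u v w m = trans
    (cong₂ _+₃_ (cong₂ _+₃_ (section₂-σ₃ u m) (trans (q-⊛ (σ₃ v) (m * 3 + 2)) (section₂-shiftσ₃ v m)))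
                (q-⊛-q-⊛ (σ₃ w) (m * 3 + 2)))
    (section₂-shift²σ₃ w m)

  sq : Series → Series
  sq f = f ⊛ f

  sq-cong : ∀ {f g} → f ≋ g → sq f ≋ sq g
  sq-cong f≋g = ⊛-cong f≋g f≋g

  ⊛-sq≋σ₃ : ∀ ψ → ψ ⊛ sq ψ ≋ σ₃ ψ
  ⊛-sq≋σ₃ ψ = ≋-trans (≋-sym (⊛-assoc ψ ψ ψ)) (frobenius ψ)

  -- ψ ⊛ cofactor ψ ≋ ψ²⁷ by Frobenius, so cofactor ψ plays the role of ψ²⁶.
  cofactor : Series → Series
  cofactor ψ = sq ψ ⊛ σ₃ (sq ψ ⊛ σ₃ (sq ψ))

  ⊛-cofactor : ∀ ψ → ψ ⊛ cofactor ψ ≋ σ₃ (σ₃ (σ₃ ψ))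
  ⊛-cofactor ψ = cube-⊛σ₃ (cube-⊛σ₃ (⊛-sq≋σ₃ ψ))
    where
    cube-⊛σ₃ : ∀ {g h} → ψ ⊛ g ≋ h → ψ ⊛ (sq ψ ⊛ σ₃ g) ≋ σ₃ h
    cube-⊛σ₃ {g} ψg≋h = ≋-trans (≋-sym (⊛-assoc ψ (sq ψ) (σ₃ g)))
      (≋-trans (⊛-cong (⊛-sq≋σ₃ ψ) ≋-refl) (≋-trans (≋-sym (σ₃-⊛ ψ g)) (σ₃-cong ψg≋h)))

  module _ {ψ : Series} (ψ₂≋0 : section 2 ψ ≋ 0s) (ψ₁≋σ₃ψ : section 1 ψ ≋ σ₃ ψ) where

    private
      module ℛ = CommutativeRing commutativeRing
      open import Relation.Binary.Reasoning.Setoid ℛ.setoid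
      a = section 0 ψ
      b = section 1 ψ

    section₂-sq : section 2 (sq ψ) ≋ σ₃ (sq ψ)
    section₂-sq = begin
      section 2 (sq ψ)
        ≈⟨ section-cong 2 (sq-cong ψ≋) ⟩
      section 2 (sq (σ₃ a ⊕ q ⊛ σ₃ b))
        ≈⟨ section-cong 2 expand ⟩
      section 2 (σ₃ (sq a) ⊕ q ⊛ σ₃ (a ⊛ b ⊕ a ⊛ b) ⊕ q ⊛ (q ⊛ σ₃ (sq b)))
        ≈⟨ section₂-trisection (sq a) _ (sq b) ⟩
      sq b
        ≈⟨ sq-cong ψ₁≋σ₃ψ ⟩
      sq (σ₃ ψ)
        ≈⟨ σ₃-⊛ ψ ψ ⟨
      σ₃ (sq ψ)
        ∎
      where
      ψ≋ : ψ ≋ σ₃ a ⊕ q ⊛ σ₃ b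
      ψ≋ = begin
        ψ                                                   ≈⟨ trisection ψ ⟩
        σ₃ a ⊕ q ⊛ σ₃ b ⊕ q ⊛ (q ⊛ σ₃ (section 2 ψ))        ≈⟨ ℛ.+-congˡ (ℛ.*-congˡ (ℛ.*-congˡ σ₃ψ₂≋0)) ⟩
        σ₃ a ⊕ q ⊛ σ₃ b ⊕ q ⊛ (q ⊛ const 0₃)               ≈⟨ solve 3 (λ A B X → A :+ X :* B :+ X :* (X :* con 0₃) := A :+ X :* B)
                                                                      ≋-refl (σ₃ a) (σ₃ b) q ⟩
        σ₃ a ⊕ q ⊛ σ₃ b                                     ∎
        where
        σ₃ψ₂≋0 : σ₃ (section 2 ψ) ≋ const 0₃
        σ₃ψ₂≋0 = ≋-trans (σ₃-cong ψ₂≋0) (≋-trans σ₃-0s (≋-sym const-0))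
      expand : sq (σ₃ a ⊕ q ⊛ σ₃ b) ≋ σ₃ (sq a) ⊕ q ⊛ σ₃ (a ⊛ b ⊕ a ⊛ b) ⊕ q ⊛ (q ⊛ σ₃ (sq b))
      expand = ≋-trans (solve 3 (λ A B X → (A :+ X :* B) :* (A :+ X :* B) := A :* A :+ X :* (A :* B :+ A :* B) :+ X :* (X :* (B :* B)))
                              ≋-refl (σ₃ a) (σ₃ b) q)
        (λ n → cong₂ _+₃_ (cong₂ _+₃_ (sym (σ₃-⊛ a a n)) (⊛-cong ≋-refl (≋-sym σ₃-double) n))
                          (⊛-cong ≋-refl (⊛-cong ≋-refl (≋-sym (σ₃-⊛ b b))) n))
        where
        σ₃-double : σ₃ (a ⊛ b ⊕ a ⊛ b) ≋ σ₃ a ⊛ σ₃ b ⊕ σ₃ a ⊛ σ₃ b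
        σ₃-double = ≋-trans (σ₃-⊕ _ _) (λ k → cong₂ _+₃_ (σ₃-⊛ a b k) (σ₃-⊛ a b k))

    section₂³-cofactor : section 2 (section 2 (section 2 (cofactor ψ))) ≋ 0s
    section₂³-cofactor = begin
      section 2 (section 2 (section 2 (P ⊛ σ₃ (P ⊛ σ₃ P))))   ≈⟨ section-cong 2 (section-cong 2 (section-⊛σ₃ 2<3 P _)) ⟩
      section 2 (section 2 (section 2 P ⊛ (P ⊛ σ₃ P)))       ≈⟨ section-cong 2 (section-cong 2 first) ⟩
      section 2 (section 2 (P ⊛ σ₃ (P ⊛ P)))                 ≈⟨ section-cong 2 (section-⊛σ₃ 2<3 P _) ⟩
      section 2 (section 2 P ⊛ (P ⊛ P))                      ≈⟨ section-cong 2 second ⟩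
      section 2 (ψ ⊛ σ₃ (ψ ⊛ P))                             ≈⟨ section-⊛σ₃ 2<3 ψ _ ⟩
      section 2 ψ ⊛ (ψ ⊛ P)                                  ≈⟨ ℛ.*-congʳ ψ₂≋0 ⟩
      0s ⊛ (ψ ⊛ P)                                           ≈⟨ ⊛-zeroˡ _ ⟩
      0s                                                     ∎
      where
      P = sq ψ
      2<3 = ℕ.n<1+n 2
      first : section 2 P ⊛ (P ⊛ σ₃ P) ≋ P ⊛ σ₃ (P ⊛ P)
      first = begin
        section 2 P ⊛ (P ⊛ σ₃ P)   ≈⟨ ℛ.*-congʳ section₂-sq ⟩
        σ₃ P ⊛ (P ⊛ σ₃ P)          ≈⟨ solve 2 (λ p s → s :* (p :* s) := p :* (s :* s)) ≋-refl P (σ₃ P) ⟩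
        P ⊛ (σ₃ P ⊛ σ₃ P)          ≈⟨ ℛ.*-congˡ (σ₃-⊛ P P) ⟨
        P ⊛ σ₃ (P ⊛ P)             ∎
      second : section 2 P ⊛ (P ⊛ P) ≋ ψ ⊛ σ₃ (ψ ⊛ P)
      second = begin
        section 2 P ⊛ (P ⊛ P)      ≈⟨ ℛ.*-congʳ section₂-sq ⟩
        σ₃ P ⊛ (P ⊛ P)             ≈⟨ solve 2 (λ y s → s :* ((y :* y) :* (y :* y)) := y :* ((y :* (y :* y)) :* s)) ≋-refl ψ (σ₃ P) ⟩
        ψ ⊛ ((ψ ⊛ P) ⊛ σ₃ P)       ≈⟨ ℛ.*-congˡ (ℛ.*-congʳ (⊛-sq≋σ₃ ψ)) ⟩
        ψ ⊛ (σ₃ ψ ⊛ σ₃ P)          ≈⟨ ℛ.*-congˡ (σ₃-⊛ ψ P) ⟨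
        ψ ⊛ σ₃ (ψ ⊛ P)             ∎

  sections-vanish : ∀ {M Φ ψ r₁ r₂ r₃} → r₁ < 3 → r₂ < 3 → r₃ < 3 → ψ 0 ≡ 1₃ → M ⊛ ψ ≋ Φ →
    section r₁ (section r₂ (section r₃ (Φ ⊛ cofactor ψ))) ≋ 0s → section r₁ (section r₂ (section r₃ M)) ≋ 0s
  sections-vanish {M} {Φ} {ψ} {r₁} {r₂} {r₃} r₁<3 r₂<3 r₃<3 ψ₀≡1 Mψ≋Φ Φψ²⁶≋0 = ⊛-cancelʳ ψ ψ₀≡1 (begin
    section r₁ (section r₂ (section r₃ M)) ⊛ ψ                ≈⟨ sections-⊛ ⟨
    section r₁ (section r₂ (section r₃ (M ⊛ σ₃ (σ₃ (σ₃ ψ))))) ≈⟨ section-cong r₁ (section-cong r₂ (section-cong r₃ M⊛ψ²⁷)) ⟩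
    section r₁ (section r₂ (section r₃ (Φ ⊛ cofactor ψ)))     ≈⟨ Φψ²⁶≋0 ⟩
    0s                                                        ∎)
    where
    module ℛ = CommutativeRing commutativeRing
    open import Relation.Binary.Reasoning.Setoid ℛ.setoid
    sections-⊛ : section r₁ (section r₂ (section r₃ (M ⊛ σ₃ (σ₃ (σ₃ ψ))))) ≋ section r₁ (section r₂ (section r₃ M)) ⊛ ψ
    sections-⊛ = ≋-trans (section-cong r₁ (section-cong r₂ (section-⊛σ₃ r₃<3 M (σ₃ (σ₃ ψ)))))
                 (≋-trans (section-cong r₁ (section-⊛σ₃ r₂<3 (section r₃ M) (σ₃ ψ))) (section-⊛σ₃ r₁<3 _ ψ))
    M⊛ψ²⁷ : M ⊛ σ₃ (σ₃ (σ₃ ψ)) ≋ Φ ⊛ cofactor ψ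
    M⊛ψ²⁷ = ≋-trans (ℛ.*-congˡ (≋-sym (⊛-cofactor ψ))) (≋-trans (≋-sym (⊛-assoc M ψ _)) (ℛ.*-congʳ Mψ≋Φ))

module BinomialMod3 where

  open import Data.Nat as ℕ using (ℕ; zero; suc; _+_; _*_; _<_; s≤s)
  open import Data.Nat.DivMod using (_%_; _/_; m≡m%n+[m/n]*n; m%n<n)
  import Data.Nat.Properties as ℕ
  open import Relation.Binary.PropositionalEquality

  open Mod3
  open 𝔽₃-Solver using (solve; _:=_; _:+_; _:*_)

  infix 8 _C₃_
  _C₃_ : ℕ → ℕ → 𝔽₃
  n     C₃ zero  = 1₃
  zero  C₃ suc r = 0₃
  suc n C₃ suc r = n C₃ r +₃ n C₃ suc r

  n<r⇒C₃≡0 : ∀ {n r} → n < r → n C₃ r ≡ 0₃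
  n<r⇒C₃≡0 {zero}  {suc r} _         = refl
  n<r⇒C₃≡0 {suc n} {suc r} (s≤s n<r) = cong₂ _+₃_ (n<r⇒C₃≡0 n<r) (n<r⇒C₃≡0 (ℕ.m<n⇒m<1+n n<r))

  -- (1 + x)⁹ ≡ 1 + x⁹ modulo 3
  private
    C₃-9+-low : ∀ m r → r < 9 → (9 + m) C₃ r ≡ m C₃ r
    C₃-9+-low m       zero          _ = refl
    C₃-9+-low zero    1             _ = refl
    C₃-9+-low zero    2             _ = refl
    C₃-9+-low zero    3             _ = refl
    C₃-9+-low zero    4             _ = refl
    C₃-9+-low zero    5             _ = refl
    C₃-9+-low zero    6             _ = refl
    C₃-9+-low zero    7             _ = refl
    C₃-9+-low zero    8             _ = refl
    C₃-9+-low zero    (suc (suc (suc (suc (suc (suc (suc (suc (suc _))))))))) (s≤s (s≤s (s≤s (s≤s (s≤s (s≤s (s≤s (s≤s (s≤s ())))))))))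
    C₃-9+-low (suc m) (suc r) (s≤s r<8) = cong₂ _+₃_ (C₃-9+-low m r (ℕ.m<n⇒m<1+n r<8)) (C₃-9+-low m (suc r) (s≤s r<8))

    C₃-9+-high : ∀ m r → (9 + m) C₃ (9 + r) ≡ m C₃ (9 + r) +₃ m C₃ r
    C₃-9+-high zero    zero    = refl
    C₃-9+-high zero    (suc r) = n<r⇒C₃≡0 (ℕ.m≤m+n 10 r)
    C₃-9+-high (suc m) zero    = begin
      (9 + m) C₃ 8 +₃ (9 + m) C₃ 9      ≡⟨ cong₂ _+₃_ (C₃-9+-low m 8 (ℕ.n<1+n 8)) (C₃-9+-high m 0) ⟩
      m C₃ 8 +₃ (m C₃ 9 +₃ m C₃ 0)      ≡⟨ solve 3 (λ a b c → a :+ (b :+ c) := (a :+ b) :+ c) refl (m C₃ 8) (m C₃ 9) (m C₃ 0) ⟩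
      (m C₃ 8 +₃ m C₃ 9) +₃ m C₃ 0      ∎
      where open ≡-Reasoning
    C₃-9+-high (suc m) (suc r) = begin
      (9 + m) C₃ (9 + r) +₃ (9 + m) C₃ (10 + r)                   ≡⟨ cong₂ _+₃_ (C₃-9+-high m r) (C₃-9+-high m (suc r)) ⟩
      (m C₃ (9 + r) +₃ m C₃ r) +₃ (m C₃ (10 + r) +₃ m C₃ suc r)   ≡⟨ solve 4 (λ a b c d → (a :+ b) :+ (c :+ d) := (a :+ c) :+ (b :+ d)) refl
                                                                         (m C₃ (9 + r)) (m C₃ r) (m C₃ (10 + r)) (m C₃ suc r) ⟩
      (m C₃ (9 + r) +₃ m C₃ (10 + r)) +₃ (m C₃ r +₃ m C₃ suc r)   ∎
      where open ≡-Reasoning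

  lucas : ∀ a c b d → b < 9 → d < 9 → (a * 9 + b) C₃ (c * 9 + d) ≡ a C₃ c *₃ b C₃ d
  lucas zero    zero    b d _   _   = refl
  lucas zero    (suc c) b d b<9 _   = n<r⇒C₃≡0 (ℕ.≤-trans b<9 (ℕ.m≤m+n 9 _))
  lucas (suc a) zero    b d b<9 d<9 = trans (C₃-9+-low (a * 9 + b) d d<9) (lucas a 0 b d b<9 d<9)
  lucas (suc a) (suc c) b d b<9 d<9 = begin
    (9 + (a * 9 + b)) C₃ (9 + (c * 9 + d))                  ≡⟨ C₃-9+-high (a * 9 + b) (c * 9 + d) ⟩
    (a * 9 + b) C₃ (suc c * 9 + d) +₃ (a * 9 + b) C₃ (c * 9 + d)
                                                           ≡⟨ cong₂ _+₃_ (lucas a (suc c) b d b<9 d<9) (lucas a c b d b<9 d<9) ⟩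
    a C₃ suc c *₃ b C₃ d +₃ a C₃ c *₃ b C₃ d                ≡⟨ solve 3 (λ x y z → x :* z :+ y :* z := (y :+ x) :* z) refl (a C₃ suc c) (a C₃ c) (b C₃ d) ⟩
    (a C₃ c +₃ a C₃ suc c) *₃ b C₃ d                        ∎
    where open ≡-Reasoning

  lucas-% : ∀ n c d → d < 9 → n C₃ (c * 9 + d) ≡ (n / 9) C₃ c *₃ (n % 9) C₃ d
  lucas-% n c d d<9 = trans (cong (_C₃ (c * 9 + d)) n≡) (lucas (n / 9) c (n % 9) d (m%n<n n 9) d<9)
    where
    n≡ : n ≡ (n / 9) * 9 + n % 9
    n≡ = trans (m≡m%n+[m/n]*n n 9) (ℕ.+-comm (n % 9) _)

  C₃-pascal² : ∀ m r → (2 + m) C₃ (2 + r) +₃ m C₃ (2 + r) ≡ m C₃ r +₃ ((1 + m) C₃ (2 + r) +₃ (1 + m) C₃ (2 + r))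
  C₃-pascal² m r = solve 3 (λ a b c → ((a :+ b) :+ (b :+ c)) :+ c := a :+ ((b :+ c) :+ (b :+ c))) refl
                     (m C₃ r) (m C₃ suc r) (m C₃ (2 + r))

module ThetaSeries where

  open import Data.Empty using (⊥-elim)
  open import Data.Nat as ℕ using (ℕ; suc; _+_; _*_; _<_; _≤_; _∸_; z≤n; s≤s; z<s; NonZero)
  import Data.Nat.Properties as ℕ
  open import Data.Product using (∃; _,_; proj₁; proj₂)
  open import Data.Sum using (_⊎_; inj₁; inj₂)
  open import Relation.Binary.PropositionalEquality
  open import Relation.Nullary using (Dec; yes; no)

  open Mod3
  open SeriesMod3
  open TriangularNumbers

  open CommutativeRing 𝔽₃-commutativeRing using () renaming (zeroʳ to *-zeroʳ)

  θ : (ℕ → 𝔽₃) → Series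
  θ a n with triangular? n
  ... | yes (k , _) = a k
  ... | no  _       = 0₃

  θ-tri : ∀ a k → θ a (tri k) ≡ a k
  θ-tri a k with triangular? (tri k)
  ... | yes (k′ , e) = cong a (tri-injective e)
  ... | no  ¬tri     = ⊥-elim (¬tri (k , refl))

  θ-¬tri : ∀ a {n} → (∀ k → tri k ≢ n) → θ a n ≡ 0₃
  θ-¬tri a {n} ¬tri with triangular? n
  ... | yes (k , e) = ⊥-elim (¬tri k e)
  ... | no  _       = refl

  θ-partial : ∀ v {N n} → n ≤ N → ∑[ k ≤ N ] shiftBy (tri k) (const (v k)) n ≡ θ v n
  θ-partial v {N} {n} n≤N with triangular? n
  ... | yes (k₀ , refl) = trans (∑≤-single N k₀ (ℕ.≤-trans (n≤tri k₀) n≤N) others) (shiftBy-const-≡ (tri k₀) (v k₀))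
    where
    others : ∀ k → k ≤ N → k ≢ k₀ → shiftBy (tri k) (const (v k)) (tri k₀) ≡ 0₃
    others k _ k≢k₀ = shiftBy-const-≢ (tri k) (v k) (λ e → k≢k₀ (tri-injective (sym e)))
  ... | no ¬tri = ∑≤-zero N (λ k _ → shiftBy-const-≢ (tri k) (v k) (λ e → ¬tri (k , sym e)))

  θ-⊛-vanish : ∀ a h n → (∀ k → tri k ≤ n → a k ≡ 0₃ ⊎ h (n ∸ tri k) ≡ 0₃) → (θ a ⊛ h) n ≡ 0₃
  θ-⊛-vanish a h n vanish = trans (coeff-⊛ (θ a) h n) (∑≤-zero n term)
    where
    term : ∀ j → j ≤ n → θ a j *₃ h (n ∸ j) ≡ 0₃
    term j j≤n with triangular? j
    ... | no _ = refl
    ... | yes (k , refl) with vanish k j≤n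
    ...   | inj₁ aₖ≡0 = cong (_*₃ h (n ∸ tri k)) aₖ≡0
    ...   | inj₂ h≡0  = trans (cong (a k *₃_) h≡0) (*-zeroʳ (a k))

  ψ : Series
  ψ = θ (λ _ → 1₃)

  ψ-tri : ∀ k → ψ (tri k) ≡ 1₃
  ψ-tri = θ-tri (λ _ → 1₃)

  ψ-¬tri : ∀ {n} → (∀ k → tri k ≢ n) → ψ n ≡ 0₃
  ψ-¬tri = θ-¬tri (λ _ → 1₃)

  ψ-0 : ψ 0 ≡ 1₃
  ψ-0 = ψ-tri 0

  ψ-section₂ : section 2 ψ ≋ 0s
  ψ-section₂ m = ψ-¬tri {m * 3 + 2} (λ k → tri≢3m+2 k m)

  private
    tri≢[3j+r]*3+1 : ∀ j r → r < 3 → .{{_ : NonZero r}} → ∀ k → tri k ≢ (j * 3 + r) * 3 + 1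
    tri≢[3j+r]*3+1 j (suc r) r<3 k e with tri≡3m+1 {k} e
    ... | i , eq with () ← proj₁ (divMod-unique 3 j (tri i) r<3 z<s (trans eq (sym (ℕ.+-identityʳ _))))

  ψ-section₁ : section 1 ψ ≋ σ₃ ψ
  ψ-section₁ m with divMod 3 m
  ... | j , 0 , _ , refl = trans (residue₀ (triangular? j)) (sym (σ₃-coeff₀ ψ j))
    where
    residue₀ : Dec (∃ λ i → tri i ≡ j) → ψ ((j * 3 + 0) * 3 + 1) ≡ ψ j
    residue₀ (yes (i , refl)) = begin
      ψ ((tri i * 3 + 0) * 3 + 1)   ≡⟨ cong (λ x → ψ (x * 3 + 1)) (ℕ.+-identityʳ (tri i * 3)) ⟩
      ψ ((tri i * 3) * 3 + 1)         ≡⟨ cong ψ (tri-3j+1 i) ⟨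
      ψ (tri (i * 3 + 1))               ≡⟨ ψ-tri (i * 3 + 1) ⟩
      1₃                                    ≡⟨ ψ-tri i ⟨
      ψ (tri i)                             ∎
      where open ≡-Reasoning
    residue₀ (no ¬tri) = trans (ψ-¬tri not-tri) (sym (ψ-¬tri {j} λ k e → ¬tri (k , e)))
      where
      not-tri : ∀ k → tri k ≢ (j * 3 + 0) * 3 + 1
      not-tri k e with tri≡3m+1 {k} e
      ... | i , eq = ¬tri (i , sym (proj₂ (divMod-unique 3 j (tri i) z<s z<s (trans eq (sym (ℕ.+-identityʳ _))))))
  ... | j , 1 , _ , refl = trans (ψ-¬tri (tri≢[3j+r]*3+1 j 1 (s≤s (s≤s z≤n)))) (sym (σ₃-coeff₁ ψ j))
  ... | j , 2 , _ , refl = trans (ψ-¬tri (tri≢[3j+r]*3+1 j 2 (ℕ.n<1+n 2))) (sym (σ₃-coeff₂ ψ j))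
  ... | _ , suc (suc (suc _)) , s≤s (s≤s (s≤s ())) , _

module MOSeries where

  open import Data.Bool using (Bool; true; false; if_then_else_; _∧_)
  open import Data.Bool.Properties using (if-float; T-≡; ¬-not; ∧-zeroʳ; ∧-identityʳ)
  open import Data.Integer as ℤ using (+_; 0ℤ)
  open import Data.Nat as ℕ using (ℕ; zero; suc; _+_; _≤_; _<_; _∸_; _≤ᵇ_; _≡ᵇ_)
  open import Data.Nat.DivMod using (_%_; _/_; [m+n]%n≡m%n; m/n≡1+[m∸n]/n; m<n⇒m%n≡m; m<n⇒m/n≡0)
  import Data.Nat.Properties as ℕ
  open import Function.Bundles using (Equivalence)
  open import Relation.Binary.Definitions using (tri<; tri≈; tri>)
  open import Relation.Binary.PropositionalEquality
  open import Relation.Nullary using (Dec; yes; no)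
  open import Relation.Nullary.Decidable using (does; dec-true; dec-false)
  open import Data.Nat.Tactic.RingSolver using (solve-∀)
  open import Data.Product using (_,_)

  open import Defs
  open Mod3
  open SeriesMod3

  open CommutativeRing 𝔽₃-commutativeRing using (+-identityʳ)

  -- E m t = Σ_{m ≤ n₁ < … < n_t} Π_k q^{n_k}/(1 + q^{n_k})² and Y m = q^m/(1 + q^m)², reduced mod 3
  E : ℕ → ℕ → Series
  E m t n = fromℤ (F (+ 2) t m n)

  Y : ℕ → Series
  Y m j = fromℤ (g (+ 2) m j)

  c₃ : ℕ → 𝔽₃
  c₃ i = fromℤ (c (+ 2) i)

  fromℤ-Σ≤ : ∀ n h → fromℤ (Σ≤ n h) ≡ ∑[ j ≤ n ] fromℤ (h j)
  fromℤ-Σ≤ zero    h = refl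
  fromℤ-Σ≤ (suc n) h = trans (fromℤ-+ (Σ≤ n h) (h (suc n))) (cong (_+₃ fromℤ (h (suc n))) (fromℤ-Σ≤ n h))

  private
    ≤ᵇ-true : ∀ {m n} → m ≤ n → (m ≤ᵇ n) ≡ true
    ≤ᵇ-true m≤n = Equivalence.to T-≡ (ℕ.≤⇒≤ᵇ m≤n)

    ≤ᵇ-false : ∀ {m n} → n < m → (m ≤ᵇ n) ≡ false
    ≤ᵇ-false {m} {n} n<m = ¬-not (λ eq → ℕ.<⇒≱ n<m (ℕ.≤ᵇ⇒≤ m n (Equivalence.from T-≡ eq)))

  Y-< : ∀ {m j} → j < m → Y m j ≡ 0₃
  Y-< {suc m} {j} j<m rewrite m<n⇒m/n≡0 j<m | ∧-zeroʳ (j % suc m ≡ᵇ 0) = refl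

  Y-coeff : ∀ m j → Y (suc m) j ≡ (if (j % suc m ≡ᵇ 0) ∧ (1 ≤ᵇ j / suc m) then c₃ (j / suc m ∸ 1) else 0₃)
  Y-coeff m j = if-float fromℤ ((j % suc m ≡ᵇ 0) ∧ (1 ≤ᵇ j / suc m))

  Y-+ : ∀ m j → Y (suc m) (j + suc m) ≡ (if j % suc m ≡ᵇ 0 then c₃ (j / suc m) else 0₃)
  Y-+ m j = begin
    Y (suc m) (j + suc m)
      ≡⟨ Y-coeff m (j + suc m) ⟩
    (if ((j + suc m) % suc m ≡ᵇ 0) ∧ (1 ≤ᵇ (j + suc m) / suc m) then c₃ ((j + suc m) / suc m ∸ 1) else 0₃)
      ≡⟨ cong₂ (λ r d → if (r ≡ᵇ 0) ∧ (1 ≤ᵇ d) then c₃ (d ∸ 1) else 0₃) mod≡ div≡ ⟩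
    (if (j % suc m ≡ᵇ 0) ∧ true then c₃ (j / suc m) else 0₃)
      ≡⟨ cong (λ b → if b then c₃ (j / suc m) else 0₃) (∧-identityʳ _) ⟩
    (if j % suc m ≡ᵇ 0 then c₃ (j / suc m) else 0₃)
      ∎
    where
    open ≡-Reasoning
    mod≡ : (j + suc m) % suc m ≡ j % suc m
    mod≡ = [m+n]%n≡m%n j (suc m)
    div≡ : (j + suc m) / suc m ≡ 1 + j / suc m
    div≡ = trans (m/n≡1+[m∸n]/n (ℕ.m≤n+m (suc m) j)) (cong (λ x → 1 + x / suc m) (ℕ.m+n∸n≡m j (suc m)))

  c₃-rec : ∀ i → c₃ (2 + i) +₃ ((c₃ (1 + i) +₃ c₃ (1 + i)) +₃ c₃ i) ≡ 0₃
  c₃-rec i = begin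
    fromℤ (ℤ.- (+ 2) ℤ.* c (+ 2) (1 + i) ℤ.+ ℤ.- c (+ 2) i) +₃ ((c₃ (1 + i) +₃ c₃ (1 + i)) +₃ c₃ i)
      ≡⟨ cong (_+₃ ((c₃ (1 + i) +₃ c₃ (1 + i)) +₃ c₃ i))
              (trans (fromℤ-+ (ℤ.- (+ 2) ℤ.* c (+ 2) (1 + i)) (ℤ.- c (+ 2) i))
                     (cong₂ _+₃_ (fromℤ-* (ℤ.- (+ 2)) (c (+ 2) (1 + i))) (fromℤ-neg (c (+ 2) i)))) ⟩
    (1₃ *₃ c₃ (1 + i) +₃ -₃ c₃ i) +₃ ((c₃ (1 + i) +₃ c₃ (1 + i)) +₃ c₃ i)
      ≡⟨ solve 2 (λ a b → (con 1₃ :* a :+ :- b) :+ ((a :+ a) :+ b) := con 0₃) refl (c₃ (1 + i)) (c₃ i) ⟩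
    0₃ ∎
    where
    open ≡-Reasoning
    open 𝔽₃-Solver using (solve; _:=_; _:+_; _:*_; :-_; con)

  module _ (m : ℕ) where
    private
      M : ℕ
      M = suc m

    Y[1+q^M]² : ℕ → 𝔽₃
    Y[1+q^M]² n = Y M n +₃ ((shiftBy M (Y M) n +₃ shiftBy M (Y M) n) +₃ shiftBy (M + M) (Y M) n)

    private
      below : ∀ {n} → n < M → Y[1+q^M]² n ≡ shiftBy M 1s n
      below {n} n<M rewrite Y-< n<M | shiftBy-< M (Y M) n<M | shiftBy-< (M + M) (Y M) (ℕ.<-≤-trans n<M (ℕ.m≤m+n M M))
                          | shiftBy-< M 1s n<M = refl

      middle : ∀ {r} → r < M → Y[1+q^M]² (M + r) ≡ shiftBy M 1s (M + r)
      middle {r} r<M rewrite shiftBy-+ˡ M (Y M) r | Y-< r<M | shiftBy-< (M + M) (Y M) (ℕ.+-monoʳ-< M r<M)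
                           | shiftBy-+ˡ M 1s r | ℕ.+-comm M r | Y-+ m r | m<n⇒m%n≡m r<M | m<n⇒m/n≡0 r<M = lowest r
        where
        lowest : ∀ r → (if r ≡ᵇ 0 then c₃ 0 else 0₃) +₃ 0₃ ≡ 1s r
        lowest zero    = refl
        lowest (suc r) = refl

      top : ∀ s → Y[1+q^M]² (M + (M + s)) ≡ shiftBy M 1s (M + (M + s))
      top s = trans (cong₂ _+₃_ y₂ (cong₂ _+₃_ (cong₂ _+₃_ y₁ y₁) y₀)) (trans (vanish b i) (sym (shiftBy-+ˡ M 1s (M + s))))
        where
        b = s % M ≡ᵇ 0
        i = s / M
        vanish : ∀ b i → (if b then c₃ (1 + i) else 0₃) +₃ (((if b then c₃ i else 0₃) +₃ (if b then c₃ i else 0₃))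
                           +₃ (if b ∧ (1 ≤ᵇ i) then c₃ (i ∸ 1) else 0₃)) ≡ 0₃
        vanish false i       = refl
        vanish true  zero    = refl
        vanish true  (suc i) = c₃-rec i
        y₂ : Y M (M + (M + s)) ≡ (if b then c₃ (1 + i) else 0₃)
        y₂ = trans (cong (Y M) (arith M s)) (trans (Y-+ m (s + M)) (cong₂ (λ r d → if r ≡ᵇ 0 then c₃ d else 0₃) mod≡ div≡))
          where
          arith : ∀ M s → M + (M + s) ≡ (s + M) + M
          arith = solve-∀
          mod≡ : (s + M) % M ≡ s % M
          mod≡ = [m+n]%n≡m%n s M
          div≡ : (s + M) / M ≡ 1 + s / M
          div≡ = trans (m/n≡1+[m∸n]/n (ℕ.m≤n+m M s)) (cong (λ x → 1 + x / M) (ℕ.m+n∸n≡m s M))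
        y₁ : shiftBy M (Y M) (M + (M + s)) ≡ (if b then c₃ i else 0₃)
        y₁ = trans (shiftBy-+ˡ M (Y M) (M + s)) (trans (cong (Y M) (ℕ.+-comm M s)) (Y-+ m s))
        y₀ : shiftBy (M + M) (Y M) (M + (M + s)) ≡ (if b ∧ (1 ≤ᵇ i) then c₃ (i ∸ 1) else 0₃)
        y₀ = trans (cong (shiftBy (M + M) (Y M)) (sym (ℕ.+-assoc M M s))) (trans (shiftBy-+ˡ (M + M) (Y M) s) (Y-coeff m s))

    Y[1+q^M]²≡q^M : ∀ n → Y[1+q^M]² n ≡ shiftBy M 1s n
    Y[1+q^M]²≡q^M n with n ℕ.<? M
    ... | yes n<M = below n<M
    ... | no  n≮M with ℕ.m≤n⇒∃[o]m+o≡n (ℕ.≮⇒≥ n≮M)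
    ...   | r , refl with r ℕ.<? M
    ...     | yes r<M = middle r<M
    ...     | no  r≮M with ℕ.m≤n⇒∃[o]m+o≡n (ℕ.≮⇒≥ r≮M)
    ...       | s , refl = top s

  Y-factor : ∀ m → let M = suc m in Y M ⊛ ((1s ⊕ shiftBy M 1s) ⊛ (1s ⊕ shiftBy M 1s)) ≋ shiftBy M 1s
  Y-factor m = ≋-trans expand
    (λ n → trans (cong (y n +₃_) (cong₂ _+₃_ (cong₂ _+₃_ (y⊛p n) (y⊛p n)) (y⊛p⊛p n))) (Y[1+q^M]²≡q^M m n))
    where
    M = suc m
    p = shiftBy M 1s
    y = Y M
    expand : y ⊛ ((1s ⊕ p) ⊛ (1s ⊕ p)) ≋ y ⊕ ((y ⊛ p ⊕ y ⊛ p) ⊕ y ⊛ p ⊛ p)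
    expand = solve 2 (λ y p → y :* ((con 1₃ :+ p) :* (con 1₃ :+ p)) := y :+ ((y :* p :+ y :* p) :+ y :* p :* p)) ≋-refl y p
      where open 𝔽₃-AlgebraSolver commutativeRing const-homomorphism
    y⊛p : y ⊛ p ≋ shiftBy M y
    y⊛p = ≋-trans (⊛-shiftBy M y 1s) (shiftBy-cong M (⊛-identityʳ y))
    y⊛p⊛p : y ⊛ p ⊛ p ≋ shiftBy (M + M) y
    y⊛p⊛p = ≋-trans (⊛-cong y⊛p ≋-refl) (≋-trans (⊛-shiftBy M (shiftBy M y) 1s)
              (≋-trans (shiftBy-cong M (⊛-identityʳ _)) (≋-sym (shiftBy-+ M M y))))

  E-0 : ∀ m → E m 0 ≋ 1s
  E-0 m zero    = refl
  E-0 m (suc n) = refl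

  private
    convolution : ∀ t n k → fromℤ (Σ≤ n (λ j → if j ≤ᵇ n then g (+ 2) k j ℤ.* F (+ 2) t (suc k) (n ∸ j) else 0ℤ))
                            ≡ (Y k ⊛ E (suc k) t) n
    convolution t n k = begin
      fromℤ (Σ≤ n _)                                        ≡⟨ fromℤ-Σ≤ n _ ⟩
      ∑[ j ≤ n ] fromℤ (if j ≤ᵇ n then _ else 0ℤ)           ≡⟨ ∑≤-cong n (λ j j≤n → trans (cong (λ b → fromℤ (if b then term j else 0ℤ)) (≤ᵇ-true j≤n))
                                                                                      (fromℤ-* (g (+ 2) k j) (F (+ 2) t (suc k) (n ∸ j)))) ⟩
      ∑[ j ≤ n ] (Y k j *₃ E (suc k) t (n ∸ j))             ≡⟨ coeff-⊛ (Y k) (E (suc k) t) n ⟨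
      (Y k ⊛ E (suc k) t) n                                 ∎
      where
      open ≡-Reasoning
      term : ℕ → ℤ.ℤ
      term j = g (+ 2) k j ℤ.* F (+ 2) t (suc k) (n ∸ j)

    E-suc : ∀ m t n → E m (suc t) n ≡ ∑[ k ≤ n ] (if m ≤ᵇ k then (Y k ⊛ E (suc k) t) n else 0₃)
    E-suc m t n = trans (fromℤ-Σ≤ n _)
      (∑≤-cong n (λ k _ → trans (if-float fromℤ (m ≤ᵇ k)) (cong (λ x → if m ≤ᵇ k then x else 0₃) (convolution t n k))))

    split : ∀ m k x → (if m ≤ᵇ k then x else 0₃) ≡ (if suc m ≤ᵇ k then x else 0₃) +₃ (if does (k ℕ.≟ m) then x else 0₃)
    split m k x with ℕ.<-cmp k m
    ... | tri< k<m _ _ rewrite ≤ᵇ-false k<m | ≤ᵇ-false (ℕ.m<n⇒m<1+n k<m) | dec-false (k ℕ.≟ m) (ℕ.<⇒≢ k<m) = refl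
    ... | tri≈ _ refl _ rewrite ≤ᵇ-true (ℕ.≤-refl {k}) | ≤ᵇ-false (ℕ.n<1+n k) | dec-true (k ℕ.≟ k) refl = refl
    ... | tri> _ _ m<k rewrite ≤ᵇ-true (ℕ.<⇒≤ m<k) | ≤ᵇ-true m<k | dec-false (k ℕ.≟ m) (≢-sym (ℕ.<⇒≢ m<k)) = sym (+-identityʳ x)

  E-rec : ∀ m t n → E m (suc t) n ≡ E (suc m) (suc t) n +₃ (Y m ⊛ E (suc m) t) n
  E-rec m t n = begin
    E m (suc t) n
      ≡⟨ E-suc m t n ⟩
    ∑[ k ≤ n ] (if m ≤ᵇ k then h k else 0₃)
      ≡⟨ ∑≤-cong n (λ k _ → split m k (h k)) ⟩
    ∑[ k ≤ n ] ((if suc m ≤ᵇ k then h k else 0₃) +₃ (if does (k ℕ.≟ m) then h k else 0₃))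
      ≡⟨ ∑≤-distrib-+ n _ _ ⟩
    ∑[ k ≤ n ] (if suc m ≤ᵇ k then h k else 0₃) +₃ ∑[ k ≤ n ] (if does (k ℕ.≟ m) then h k else 0₃)
      ≡⟨ cong₂ _+₃_ (sym (E-suc (suc m) t n)) (lowest (m ℕ.≤? n)) ⟩
    E (suc m) (suc t) n +₃ h m
      ∎
    where
    open ≡-Reasoning
    h : ℕ → 𝔽₃
    h k = (Y k ⊛ E (suc k) t) n
    lowest : Dec (m ≤ n) → ∑[ k ≤ n ] (if does (k ℕ.≟ m) then h k else 0₃) ≡ h m
    lowest (yes m≤n) = trans (∑≤-single n m m≤n (λ k _ k≢m → cong (λ b → if b then h k else 0₃) (dec-false (k ℕ.≟ m) k≢m)))
                             (cong (λ b → if b then h m else 0₃) (dec-true (m ℕ.≟ m) refl))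
    lowest (no m≰n)  = trans (∑≤-zero n (λ k k≤n → cong (λ b → if b then h k else 0₃) (dec-false (k ℕ.≟ m) (λ { refl → m≰n k≤n }))))
                             (sym (trans (⊛-congˡ-upTo (E (suc m) t) n (λ j j≤n → Y-< (ℕ.≤-<-trans j≤n (ℕ.≰⇒> m≰n)))) (⊛-zeroˡ _ n)))

  E-high : ∀ {m n} t → n < m → E m (suc t) n ≡ 0₃
  E-high {m} {n} t n<m =
    trans (E-suc m t n) (∑≤-zero n (λ k k≤n → cong (λ b → if b then _ else 0₃) (≤ᵇ-false (ℕ.≤-<-trans k≤n n<m))))

module MainIdentity where

  open import Data.Nat as ℕ using (ℕ; zero; suc; _≤_; _<_; s≤s)
  import Data.Nat.Properties as ℕ
  open import Data.Product using (proj₁; proj₂)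
  open import Relation.Binary.PropositionalEquality

  open Mod3
  open SeriesMod3
  open TriangularNumbers using (tri)
  open BinomialMod3
  open ThetaSeries
  open MOSeries

  -- power series in z with coefficients in 𝔽₃[[q]]; a bivariate series X has coefficients X t n at zᵗqⁿ
  module B = PowerSeries commutativeRing
  𝔹 : CommutativeRing _ _
  𝔹 = B.commutativeRing
  𝔹-semiring : CommutativeSemiring _ _
  𝔹-semiring = CommutativeRing.commutativeSemiring 𝔹

  open CommutativeRing 𝔹 using (_≈_; _+_; _*_; 0#; 1#)
  open import Algebra.Properties.Semiring.Exp (CommutativeSemiring.semiring 𝔹-semiring) using (_^_)
  open import Algebra.Solver.Ring.NaturalCoefficients.Default 𝔹-semiring using (solve; _:=_; _:+_; _:*_; con)

  module 𝔹∑ = FiniteSums 𝔹-semiring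

  private
    module 𝔹 = CommutativeRing 𝔹

  q̂ z : B.Series
  q̂ = B.const q
  z = B.shift 1#

  q̂^≈ : ∀ k → q̂ ^ k ≈ B.const (shiftBy k 1s)
  q̂^≈ zero    = 𝔹.refl
  q̂^≈ (suc k) = 𝔹.trans (𝔹.*-congˡ (q̂^≈ k)) (𝔹.trans (B.≋-sym (B.const-* q (shiftBy k 1s))) (B.const-cong (q-⊛ (shiftBy k 1s))))

  q̂^-* : ∀ k X t → ((q̂ ^ k) * X) t ≋ shiftBy k (X t)
  q̂^-* k X t = ≋-trans (B.⊛-cong (q̂^≈ k) B.≋-refl t) (≋-trans (B.const-⊛ (shiftBy k 1s) X t)
                (≋-trans (shiftBy-⊛ k 1s (X t)) (shiftBy-cong k (⊛-identityˡ (X t)))))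

  coeff-∑ : ∀ N F t n → 𝔹∑.∑≤ N F t n ≡ ∑[ k ≤ N ] F k t n
  coeff-∑ zero    F t n = refl
  coeff-∑ (suc N) F t n = cong (_+₃ F (suc N) t n) (coeff-∑ N F t n)

  infix 4 _≋_[q<_]
  _≋_[q<_] : B.Series → B.Series → ℕ → Set
  X ≋ Y [q< m ] = ∀ t n → n < m → X t n ≡ Y t n

  ≈⇒≋[q<] : ∀ {X Y m} → X ≈ Y → X ≋ Y [q< m ]
  ≈⇒≋[q<] X≈Y t n _ = X≈Y t n

  ≋[q<]-sym : ∀ {X Y m} → X ≋ Y [q< m ] → Y ≋ X [q< m ]
  ≋[q<]-sym X≋Y t n n<m = sym (X≋Y t n n<m)

  ≋[q<]-trans : ∀ {X Y Z m} → X ≋ Y [q< m ] → Y ≋ Z [q< m ] → X ≋ Z [q< m ]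
  ≋[q<]-trans X≋Y Y≋Z t n n<m = trans (X≋Y t n n<m) (Y≋Z t n n<m)

  private
    ⊛-upTo : ∀ {f f′ g g′ m n} → (∀ n → n < m → f n ≡ f′ n) → (∀ n → n < m → g n ≡ g′ n) → n < m → (f ⊛ g) n ≡ (f′ ⊛ g′) n
    ⊛-upTo {f} {f′} {g} {g′} {n = n} f≈ g≈ n<m =
      trans (⊛-congˡ-upTo g n (λ k k≤n → f≈ k (ℕ.≤-<-trans k≤n n<m))) (⊛-congʳ-upTo f′ n (λ k k≤n → g≈ k (ℕ.≤-<-trans k≤n n<m)))

  ≋[q<]-* : ∀ {X X′ Y Y′ m} → X ≋ X′ [q< m ] → Y ≋ Y′ [q< m ] → X * Y ≋ X′ * Y′ [q< m ]
  ≋[q<]-* X≋X′ Y≋Y′ zero    n n<m = ⊛-upTo (X≋X′ 0) (Y≋Y′ 0) n<m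
  ≋[q<]-* X≋X′ Y≋Y′ (suc t) n n<m =
    cong₂ _+₃_ (⊛-upTo (X≋X′ 0) (Y≋Y′ (suc t)) n<m) (≋[q<]-* (λ t → X≋X′ (suc t)) Y≋Y′ t n n<m)

  open FiniteTripleProduct 𝔹-semiring q̂

  ∼⇒≋[q<] : ∀ {X Y m} → X ∼ Y [q^ m ] → X ≋ Y [q< m ]
  ∼⇒≋[q<] {X} {Y} {m} (witness W₁ W₂ eq) t n n<m = begin
    X t n                          ≡⟨ sym (+-identityʳ _) ⟩
    X t n +₃ 0₃                    ≡⟨ cong (X t n +₃_) (sym (vanish W₁)) ⟩
    (X + q̂ ^ m * W₁) t n           ≡⟨ eq t n ⟩
    (Y + q̂ ^ m * W₂) t n           ≡⟨ cong (Y t n +₃_) (vanish W₂) ⟩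
    Y t n +₃ 0₃                    ≡⟨ +-identityʳ _ ⟩
    Y t n                          ∎
    where
    open ≡-Reasoning
    open CommutativeRing 𝔽₃-commutativeRing using (+-identityʳ)
    vanish : ∀ W → (q̂ ^ m * W) t n ≡ 0₃
    vanish W = trans (q̂^-* m W t n) (shiftBy-< m (W t) n<m)

  q̂-* : ∀ W t → (q̂ * W) t ≋ shift (W t)
  q̂-* W t = ≋-trans (B.const-⊛ q W t) (q-⊛ (W t))

  ≋[q<]-cancel : ∀ V {X Y m} → (1# + q̂ * V) * X ≋ (1# + q̂ * V) * Y [q< m ] → X ≋ Y [q< m ]
  ≋[q<]-cancel V {X} {Y} {m} unit≋ = upTo m ℕ.≤-refl
    where
    expand : ∀ X → (1# + q̂ * V) * X ≈ X + q̂ * (V * X)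
    expand X = solve 3 (λ p v u → (con 1 :+ p :* v) :* u := u :+ p :* (v :* u)) 𝔹.refl q̂ V X
    cancel : ∀ a b → a ≡ (a +₃ b) +₃ -₃ b
    cancel a b = 𝔽₃-Solver.solve 2 (λ a b → a 𝔽₃-Solver.:= (a 𝔽₃-Solver.:+ b) 𝔽₃-Solver.:+ 𝔽₃-Solver.:- b) refl a b
    upTo : ∀ j → j ≤ m → X ≋ Y [q< j ]
    upTo zero    _   t n ()
    upTo (suc j) j<m t n n≤j = begin
      X t n                                           ≡⟨ cancel (X t n) _ ⟩
      (X t n +₃ (q̂ * (V * X)) t n) +₃ -₃ (q̂ * (V * X)) t n
                                                      ≡⟨ cong₂ (λ a b → a +₃ -₃ b) unit-step shifted ⟩
      (Y t n +₃ (q̂ * (V * Y)) t n) +₃ -₃ (q̂ * (V * Y)) t n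
                                                      ≡⟨ cancel (Y t n) _ ⟨
      Y t n                                           ∎
      where
      open ≡-Reasoning
      unit-step : (X + q̂ * (V * X)) t n ≡ (Y + q̂ * (V * Y)) t n
      unit-step = trans (sym (expand X t n)) (trans (unit≋ t n (ℕ.<-≤-trans n≤j j<m)) (expand Y t n))
      VX≋VY : V * X ≋ V * Y [q< j ]
      VX≋VY = ≋[q<]-* {V} {V} (λ _ _ _ → refl) (upTo j (ℕ.<⇒≤ j<m))
      shifted : (q̂ * (V * X)) t n ≡ (q̂ * (V * Y)) t n
      shifted = trans (q̂-* (V * X) t n) (trans (shift-≡ n n≤j) (sym (q̂-* (V * Y) t n)))
        where
        shift-≡ : ∀ n → n < suc j → shift ((V * X) t) n ≡ shift ((V * Y) t) n
        shift-≡ zero    _         = refl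
        shift-≡ (suc n) (s≤s n<j) = VX≋VY t n n<j

  z-* : ∀ W → z * W ≈ B.shift W
  z-* W = B.≋-trans (B.shift-⊛ 1# W) (B.shift-cong (B.⊛-identityˡ W))

  E-step : ∀ m → E m ≈ (1# + z * B.const (Y m)) * E (suc m)
  E-step m = 𝔹.sym (𝔹.trans (solve 3 (λ z y e → (con 1 :+ z :* y) :* e := e :+ z :* (y :* e)) 𝔹.refl z (B.const (Y m)) (E (suc m)))
                             (𝔹.trans (𝔹.+-congˡ (𝔹.trans (𝔹.*-congˡ (B.const-⊛ (Y m) (E (suc m)))) (z-* _))) coefficients))
    where
    open CommutativeRing 𝔽₃-commutativeRing using (+-identityʳ)
    coefficients : E (suc m) + B.shift (Y m B.· E (suc m)) ≈ E m
    coefficients zero    n = +-identityʳ _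
    coefficients (suc t) n = sym (E-rec m t n)

  G : ℕ → B.Series
  G zero    = 1#
  G (suc N) = G N * (1# + z * B.const (Y (suc N)))

  E₁≈G*E : ∀ N → E 1 ≈ G N * E (suc N)
  E₁≈G*E zero    = 𝔹.sym (𝔹.*-identityˡ (E 1))
  E₁≈G*E (suc N) = 𝔹.trans (E₁≈G*E N) (𝔹.trans (𝔹.*-congˡ (E-step (suc N))) (𝔹.sym (𝔹.*-assoc _ _ _)))

  E≋1 : ∀ N → E (suc N) ≋ 1# [q< suc N ]
  E≋1 N zero    n _   = E-0 (suc N) n
  E≋1 N (suc t) n n≤N = E-high t n≤N

  morganVoyce : ℕ → B.Series
  morganVoyce k t = const ((k ℕ.+ t) C₃ (t ℕ.+ t))

  morganVoyce-0 : morganVoyce 0 ≈ 1#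
  morganVoyce-0 zero    = ≋-refl
  morganVoyce-0 (suc t) = ≋-trans (const-cong (n<r⇒C₃≡0 (s≤s (ℕ.m≤n+m (suc t) t)))) const-0

  morganVoyce-1 : morganVoyce 1 ≈ 1# + z
  morganVoyce-1 zero          n = sym (CommutativeRing.+-identityʳ 𝔽₃-commutativeRing _)
  morganVoyce-1 (suc zero)    n = refl
  morganVoyce-1 (suc (suc t)) n = trans (const-cong (n<r⇒C₃≡0 (s≤s (s≤s (ℕ.m≤n+m (suc (suc t)) t)))) n) (const-0 n)

  morganVoyce-rec : ∀ k → morganVoyce (2 ℕ.+ k) + morganVoyce k ≈ (z + (1# + 1#)) * morganVoyce (1 ℕ.+ k)
  morganVoyce-rec k = 𝔹.sym (𝔹.trans (solve 2 (λ z m → (z :+ (con 1 :+ con 1)) :* m := z :* m :+ (m :+ m)) 𝔹.refl z (morganVoyce (1 ℕ.+ k)))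
                             (𝔹.trans (𝔹.+-congʳ (z-* (morganVoyce (1 ℕ.+ k)))) coefficients))
    where
    coefficients : B.shift (morganVoyce (1 ℕ.+ k)) + (morganVoyce (1 ℕ.+ k) + morganVoyce (1 ℕ.+ k)) ≈ morganVoyce (2 ℕ.+ k) + morganVoyce k
    coefficients zero    n       = refl
    coefficients (suc s) zero    rewrite ℕ.+-suc k s | ℕ.+-suc s s = sym (C₃-pascal² (suc (k ℕ.+ s)) (s ℕ.+ s))
    coefficients (suc s) (suc n) = refl

  module P₀ = ProductExpansion 0# (λ _ → 1#) 𝔹.refl (𝔹.sym (𝔹.+-identityʳ 1#))
                (λ _ → solve 0 (con 1 :+ con 1 := (con 0 :+ (con 1 :+ con 1)) :* con 1) 𝔹.refl)
  module Pz = ProductExpansion z morganVoyce morganVoyce-0 morganVoyce-1 morganVoyce-rec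

  private
    Y-lift : ∀ m → B.const (Y (suc m)) * ((1# + q̂ ^ suc m) * (1# + q̂ ^ suc m)) ≈ q̂ ^ suc m
    Y-lift m = begin
      B.const (Y M) * ((1# + q̂ ^ M) * (1# + q̂ ^ M))
        ≈⟨ 𝔹.*-congˡ (𝔹.*-cong (𝔹.+-congˡ (q̂^≈ M)) (𝔹.+-congˡ (q̂^≈ M))) ⟩
      B.const (Y M) * ((B.const 1s + B.const p) * (B.const 1s + B.const p))
        ≈⟨ 𝔹.*-congˡ (𝔹.*-cong (B.≋-sym (B.const-+ 1s p)) (B.≋-sym (B.const-+ 1s p))) ⟩
      B.const (Y M) * (B.const (1s ⊕ p) * B.const (1s ⊕ p))
        ≈⟨ 𝔹.sym (𝔹.trans (B.const-* (Y M) _) (𝔹.*-congˡ (B.const-* (1s ⊕ p) (1s ⊕ p)))) ⟩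
      B.const (Y M ⊛ ((1s ⊕ p) ⊛ (1s ⊕ p)))
        ≈⟨ B.const-cong (Y-factor m) ⟩
      B.const p
        ≈⟨ q̂^≈ M ⟨
      q̂ ^ M
        ∎
      where
      open import Relation.Binary.Reasoning.Setoid 𝔹.setoid
      M = suc m
      p = shiftBy M 1s

    factor-lift : ∀ m → (1# + z * B.const (Y (suc m))) * P₀.factor (suc m) ≈ Pz.factor (suc m)
    factor-lift m = 𝔹.trans (solve 4 (λ z y a p → (con 1 :+ z :* y) :* (a :+ con 0 :* p) := a :+ z :* (y :* a)) 𝔹.refl
                                     z (B.const (Y (suc m))) ((1# + q̂ ^ suc m) * (1# + q̂ ^ suc m)) (q̂ ^ suc m))
                            (𝔹.+-congˡ (𝔹.*-congˡ (Y-lift m)))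

  G*Π₀≈Πz : ∀ N → G N * P₀.Π N ≈ Pz.Π N
  G*Π₀≈Πz zero    = 𝔹.*-identityˡ 1#
  G*Π₀≈Πz (suc N) = 𝔹.trans (solve 4 (λ g f p h → (g :* f) :* (p :* h) := (g :* p) :* (f :* h)) 𝔹.refl
                                     (G N) (1# + z * B.const (Y (suc N))) (P₀.Π N) (P₀.factor (suc N)))
                            (𝔹.*-cong (G*Π₀≈Πz N) (factor-lift N))

  ψ̂ Φ̂ : ℕ → B.Series
  ψ̂ N = 𝔹∑.∑[ k ≤ N ] (q̂ ^ tri k * 1#)
  Φ̂ N = 𝔹∑.∑[ k ≤ N ] (q̂ ^ tri k * morganVoyce k)

  E₁*ψ̂≋Φ̂ : ∀ N → E 1 * ψ̂ N ≋ Φ̂ N [q< suc N ]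
  E₁*ψ̂≋Φ̂ N = ≋[q<]-cancel V (
    ≋[q<]-trans (≈⇒≋[q<] (𝔹.trans (𝔹.*-congʳ (𝔹.sym β≈)) (solve 3 (λ b e s → b :* (e :* s) := e :* (b :* s)) 𝔹.refl β (E 1) (ψ̂ N))))
    (≋[q<]-trans (≋[q<]-* {E 1} (λ _ _ _ → refl) (≋[q<]-sym (∼⇒≋[q<] (P₀.product-expansion-∼ N))))
    (≋[q<]-trans (≈⇒≋[q<] (𝔹.*-congʳ (E₁≈G*E N)))
    (≋[q<]-trans (≋[q<]-* (≋[q<]-* {G N} (λ _ _ _ → refl) (E≋1 N)) (λ _ _ _ → refl))
    (≋[q<]-trans (≈⇒≋[q<] (𝔹.trans (𝔹.*-congʳ (𝔹.*-identityʳ (G N))) (G*Π₀≈Πz N)))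
    (≋[q<]-trans (∼⇒≋[q<] (Pz.product-expansion-∼ N))
    (≈⇒≋[q<] (𝔹.*-congʳ β≈))))))))
    where
    β = qbinom (suc (N ℕ.+ N)) (suc (N ℕ.+ 0))
    V = proj₁ (qbinom≈1+q* (suc (N ℕ.+ 0)) N)
    β≈ : β ≈ 1# + q̂ * V
    β≈ = 𝔹.trans (qbinom-congˡ (suc (N ℕ.+ 0)) (cong (λ k → suc (k ℕ.+ N)) (sym (ℕ.+-identityʳ N))))
                  (proj₂ (qbinom≈1+q* (suc (N ℕ.+ 0)) N))

  Φ : ℕ → Series
  Φ t = θ (λ k → (k ℕ.+ t) C₃ (t ℕ.+ t))

  Φ̂-coeff : ∀ N t n → n ≤ N → Φ̂ N t n ≡ Φ t n
  Φ̂-coeff N t n n≤N = trans (coeff-∑ N _ t n) (trans (∑≤-cong N (λ k _ → q̂^-* (tri k) (morganVoyce k) t n)) (θ-partial _ n≤N))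

  ψ̂≋ψ : ∀ N → ψ̂ N ≋ B.const ψ [q< suc N ]
  ψ̂≋ψ N t n (s≤s n≤N) = trans (coeff-∑ N _ t n) (trans (∑≤-cong N (λ k _ → power k)) (sum t))
    where
    power : ∀ k → (q̂ ^ tri k * 1#) t n ≡ B.const (shiftBy (tri k) 1s) t n
    power k = trans (B.⊛-identityʳ (q̂ ^ tri k) t n) (q̂^≈ (tri k) t n)
    sum : ∀ t → ∑[ k ≤ N ] B.const (shiftBy (tri k) 1s) t n ≡ B.const ψ t n
    sum zero    = θ-partial (λ _ → 1₃) n≤N
    sum (suc t) = ∑≤-zero N (λ _ _ → refl)

  MO-identity : ∀ t → E 1 t ⊛ ψ ≋ Φ t
  MO-identity t n = begin
    (E 1 t ⊛ ψ) n             ≡⟨ ⊛-comm (E 1 t) ψ n ⟩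
    (ψ ⊛ E 1 t) n             ≡⟨ B.⊛-const (E 1) ψ t n ⟨
    (E 1 * B.const ψ) t n     ≡⟨ ≋[q<]-* {E 1} (λ _ _ _ → refl) (ψ̂≋ψ n) t n (ℕ.n<1+n n) ⟨
    (E 1 * ψ̂ n) t n           ≡⟨ E₁*ψ̂≋Φ̂ n t n (ℕ.n<1+n n) ⟩
    Φ̂ n t n                   ≡⟨ Φ̂-coeff n t n ℕ.≤-refl ⟩
    Φ t n                     ∎
    where open ≡-Reasoning

module Vanishing where

  open import Data.Nat as ℕ using (ℕ; suc; _+_; _*_; _≤_; _<_; _∸_; s≤s; z<s; s<s)
  open import Data.Nat.DivMod using (_%_; _/_; [m+kn]%n≡m%n)
  import Data.Nat.Properties as ℕ
  open import Data.Nat.Tactic.RingSolver using (solve-∀)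
  open import Data.Product using (∃; _,_; proj₁; proj₂)
  open import Data.Sum using (_⊎_; inj₁; inj₂)
  open import Relation.Binary.PropositionalEquality

  open import Defs
  open Mod3
  open SeriesMod3
  open TriangularNumbers
  open BinomialMod3
  open ThetaSeries
  open MOSeries
  open MainIdentity using (Φ; MO-identity)

  open CommutativeRing 𝔽₃-commutativeRing using () renaming (zeroʳ to *-zeroʳ)

  private
    digit₄ : ∀ {b} → b < 9 → b ≡ 4 ⊎ ((b + 4) % 9) C₃ 8 ≡ 0₃
    digit₄ {0} _ = inj₂ refl
    digit₄ {1} _ = inj₂ refl
    digit₄ {2} _ = inj₂ refl
    digit₄ {3} _ = inj₂ refl
    digit₄ {4} _ = inj₁ refl
    digit₄ {5} _ = inj₂ refl
    digit₄ {6} _ = inj₂ refl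
    digit₄ {7} _ = inj₂ refl
    digit₄ {8} _ = inj₂ refl
    digit₄ {suc (suc (suc (suc (suc (suc (suc (suc (suc _))))))))} (s≤s (s≤s (s≤s (s≤s (s≤s (s≤s (s≤s (s≤s (s≤s ())))))))))

    digit₇ : ∀ {b} → b < 9 → (b ≡ 1 ⊎ b ≡ 7) ⊎ ((b + 7) % 9) C₃ 5 ≡ 0₃
    digit₇ {0} _ = inj₂ refl
    digit₇ {1} _ = inj₁ (inj₁ refl)
    digit₇ {2} _ = inj₂ refl
    digit₇ {3} _ = inj₂ refl
    digit₇ {4} _ = inj₂ refl
    digit₇ {5} _ = inj₂ refl
    digit₇ {6} _ = inj₂ refl
    digit₇ {7} _ = inj₁ (inj₂ refl)
    digit₇ {8} _ = inj₂ refl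
    digit₇ {suc (suc (suc (suc (suc (suc (suc (suc (suc _))))))))} (s≤s (s≤s (s≤s (s≤s (s≤s (s≤s (s≤s (s≤s (s≤s ())))))))))

    -- Lucas: C(k + t, 2t) vanishes mod 3 as soon as the last base-9 digits do
    last-digit-vanishes : ∀ {K b J r c d} → d < 9 → (9 * J + r) + (9 * J + r) ≡ c * 9 + d → ((b + r) % 9) C₃ d ≡ 0₃ →
                          ((K * 9 + b) + (9 * J + r)) C₃ ((9 * J + r) + (9 * J + r)) ≡ 0₃
    last-digit-vanishes {K} {b} {J} {r} {c} {d} d<9 2t≡ digit≡0 = begin
      n C₃ ((9 * J + r) + (9 * J + r))   ≡⟨ cong (n C₃_) 2t≡ ⟩
      n C₃ (c * 9 + d)                   ≡⟨ lucas-% n c d d<9 ⟩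
      high *₃ (n % 9) C₃ d               ≡⟨ cong (λ m → high *₃ m C₃ d) n%9 ⟩
      high *₃ ((b + r) % 9) C₃ d         ≡⟨ cong (high *₃_) digit≡0 ⟩
      high *₃ 0₃                         ≡⟨ *-zeroʳ high ⟩
      0₃                                 ∎
      where
      open ≡-Reasoning
      n = (K * 9 + b) + (9 * J + r)
      high = (n / 9) C₃ c
      arith : ∀ K b J r → (K * 9 + b) + (9 * J + r) ≡ (b + r) + (K + J) * 9
      arith = solve-∀
      n%9 : n % 9 ≡ (b + r) % 9
      n%9 = trans (cong (_% 9) (arith K b J r)) ([m+kn]%n≡m%n (b + r) (K + J) 9)

    cofactor-26 : ∀ j → cofactor ψ (j * 27 + 26) ≡ 0₃
    cofactor-26 j = trans (cong (cofactor ψ) (arith j)) (section₂³-cofactor ψ-section₂ ψ-section₁ j)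
      where
      arith : ∀ j → j * 27 + 26 ≡ ((j * 3 + 2) * 3 + 2) * 3 + 2
      arith = solve-∀

    c*27+1+s≤27*N+s⇒c<N : ∀ {c s N} → c * 27 + suc s ≤ 27 * N + s → suc c ≤ N
    c*27+1+s≤27*N+s⇒c<N {c} {s} {N} le =
      ℕ.≰⇒> (λ N≤c → ℕ.<-irrefl refl (ℕ.≤-trans (s≤s (bound N≤c)) (subst (_≤ 27 * N + s) (ℕ.+-suc (c * 27) s) le)))
      where
      bound : N ≤ c → 27 * N + s ≤ c * 27 + s
      bound N≤c = ℕ.+-monoˡ-≤ s (subst (27 * N ℕ.≤_) (ℕ.*-comm 27 c) (ℕ.*-monoʳ-≤ 27 N≤c))

    gap-26 : ∀ {c s N j} → suc c + j ≡ N → 27 * N + s ∸ (c * 27 + suc s) ≡ j * 27 + 26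
    gap-26 {c} {s} {N} {j} e = trans (cong (_∸ (c * 27 + suc s)) (arith c j s N e)) (ℕ.m+n∸m≡n (c * 27 + suc s) (j * 27 + 26))
      where
      arith : ∀ c j s N → suc c + j ≡ N → 27 * N + s ≡ (c * 27 + suc s) + (j * 27 + 26)
      arith c j s N refl = arith′ c j s
        where
        arith′ : ∀ c j s → 27 * (suc c + j) + s ≡ (c * 27 + suc s) + (j * 27 + 26)
        arith′ = solve-∀

    -- tri k ≡ -1 - s (mod 27) puts n - tri k in the residue class 26 that the cofactor ψ²⁶ misses
    cofactor-gap : ∀ {k c s} N → tri k ≡ c * 27 + suc s → tri k ≤ 27 * N + s → cofactor ψ (27 * N + s ∸ tri k) ≡ 0₃
    cofactor-gap {k} {c} {s} N tri≡ tri≤ =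
      trans (cong (λ m → cofactor ψ (27 * N + s ∸ m)) tri≡)
            (trans (cong (cofactor ψ) (gap-26 {c} {s} {N} {proj₁ j,e} (proj₂ j,e))) (cofactor-26 (proj₁ j,e)))
      where
      j,e : ∃ λ j → suc c + j ≡ N
      j,e = ℕ.m≤n⇒∃[o]m+o≡n (c*27+1+s≤27*N+s⇒c<N (subst (_≤ 27 * N + s) tri≡ tri≤))

  Φ⊛cofactor-vanishes₄ : ∀ J N → (Φ (9 * J + 4) ⊛ cofactor ψ) (27 * N + 9) ≡ 0₃
  Φ⊛cofactor-vanishes₄ J N = θ-⊛-vanish _ (cofactor ψ) (27 * N + 9) term
    where
    t = 9 * J + 4
    arith : ∀ J → (9 * J + 4) + (9 * J + 4) ≡ (J + J) * 9 + 8
    arith = solve-∀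
    term : ∀ k → tri k ≤ 27 * N + 9 → (k + t) C₃ (t + t) ≡ 0₃ ⊎ cofactor ψ (27 * N + 9 ∸ tri k) ≡ 0₃
    term k tri≤ with divMod 9 k
    ... | K , b , b<9 , refl with digit₄ b<9
    ...   | inj₁ refl    = inj₂ (cofactor-gap {K * 9 + 4} {proj₁ (tri-9K+3r+1 K 1)} {9} N (proj₂ (tri-9K+3r+1 K 1)) tri≤)
    ...   | inj₂ digit≡0 = inj₁ (last-digit-vanishes {K} {b} {J} {4} {J + J} {8} (ℕ.n<1+n 8) (arith J) digit≡0)

  Φ⊛cofactor-vanishes₇ : ∀ J N → (Φ (9 * J + 7) ⊛ cofactor ψ) (27 * N + 0) ≡ 0₃
  Φ⊛cofactor-vanishes₇ J N = θ-⊛-vanish _ (cofactor ψ) (27 * N + 0) term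
    where
    t = 9 * J + 7
    arith : ∀ J → (9 * J + 7) + (9 * J + 7) ≡ (J + J + 1) * 9 + 5
    arith = solve-∀
    arith′ : ∀ c → c * 27 + 28 ≡ suc c * 27 + 1
    arith′ = solve-∀
    term : ∀ k → tri k ≤ 27 * N + 0 → (k + t) C₃ (t + t) ≡ 0₃ ⊎ cofactor ψ (27 * N + 0 ∸ tri k) ≡ 0₃
    term k tri≤ with divMod 9 k
    ... | K , b , b<9 , refl with digit₇ b<9
    ...   | inj₁ (inj₁ refl) = inj₂ (cofactor-gap {K * 9 + 1} {proj₁ (tri-9K+3r+1 K 0)} {0} N (proj₂ (tri-9K+3r+1 K 0)) tri≤)
    ...   | inj₁ (inj₂ refl) = inj₂ (cofactor-gap {K * 9 + 7} {suc (proj₁ (tri-9K+3r+1 K 2))} {0} N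
                                                   (trans (proj₂ (tri-9K+3r+1 K 2)) (arith′ (proj₁ (tri-9K+3r+1 K 2)))) tri≤)
    ...   | inj₂ digit≡0     = inj₁ (last-digit-vanishes {K} {b} {J} {7} {J + J + 1} {5}
                                                          (ℕ.≤-trans (ℕ.n<1+n 5) (ℕ.m≤n+m 6 3)) (arith J) digit≡0)

  MO-vanishes₄ : ∀ J N → E 1 (9 * J + 4) (27 * N + 9) ≡ 0₃
  MO-vanishes₄ J N = trans (cong (E 1 t) (arith N)) (sections-vanish (s<s z<s) z<s z<s ψ-0 (MO-identity t) vanish N)
    where
    t = 9 * J + 4
    arith : ∀ N → 27 * N + 9 ≡ ((N * 3 + 1) * 3 + 0) * 3 + 0
    arith = solve-∀
    vanish : section 1 (section 0 (section 0 (Φ t ⊛ cofactor ψ))) ≋ 0s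
    vanish m = trans (cong (Φ t ⊛ cofactor ψ) (sym (arith m))) (Φ⊛cofactor-vanishes₄ J m)

  MO-vanishes₇ : ∀ J N → E 1 (9 * J + 7) (27 * N) ≡ 0₃
  MO-vanishes₇ J N = trans (cong (E 1 t) (arith N)) (sections-vanish z<s z<s z<s ψ-0 (MO-identity t) vanish N)
    where
    t = 9 * J + 7
    arith : ∀ N → 27 * N ≡ ((N * 3 + 0) * 3 + 0) * 3 + 0
    arith = solve-∀
    vanish : section 0 (section 0 (section 0 (Φ t ⊛ cofactor ψ))) ≋ 0s
    vanish m = trans (cong (Φ t ⊛ cofactor ψ) (trans (sym (arith m)) (sym (ℕ.+-identityʳ (27 * m))))) (Φ⊛cofactor-vanishes₇ J m)

open import Defs
open import Data.Nat using (ℕ; _+_; _*_)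
open import Data.Integer using (+_)
open import Data.Integer.Divisibility using (_∣_)
open import Data.Product using (_×_; _,_)
open Mod3 using (fromℤ≡0⇒3∣)
open Vanishing using (MO-vanishes₄; MO-vanishes₇)

theorem5p1 : (J N : ℕ) →
    ((+ 3) ∣ MO (+ 2) (9 * J + 4) (27 * N + 9)) × ((+ 3) ∣ MO (+ 2) (9 * J + 7) (27 * N))
theorem5p1 J N =
  fromℤ≡0⇒3∣ (MO (+ 2) (9 * J + 4) (27 * N + 9)) (MO-vanishes₄ J N) ,
  fromℤ≡0⇒3∣ (MO (+ 2) (9 * J + 7) (27 * N)) (MO-vanishes₇ J N)
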